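{- Let $n\ge1$. The map $\zeta_C:\mathcal L_{n,n}\to\mathcal B_n$ is a bijection, and $\operatorname{dinv}(\pi)=\operatorname{area}(\zeta_C(\pi))$ for every $\pi\in\mathcal L_{n,n}$.
   Context: $\mathcal L_{n,n}$: lattice paths from $(0,0)$ to $(n,n)$ with steps $N=(0,1)$, $E=(1,0)$. $\mathcal B_n$: ballot paths, i.e. lattice paths from $(0,0)$ with $2n$ steps in $\{N,E\}$ never going below the line $x=y$. Type $C$ area vector of $\pi\in\mathcal L_{n,n}$: $(a_1,\dots,a_n)$ with $a_i=i-b_i$, where $b_i$ is the $x$-coordinate of the $i$-th North step of $\pi$ (the number of boxes in row $i$ to the left of $\pi$). Define $\operatorname{dinv}(\pi)=\#\{(i,j):i<j,a_i=a_j\}+\#\{(i,j):i<j,a_i=a_j+1\}+\#\{(i,j):i<j,a_i=-a_j\}+\#\{(i,j):i<j,a_i=-a_j+1\}+\#\{i:a_i=0\}$ (a pair may be counted in several terms). The map $\zeta_C$: given $\pi$ with area vector $(a_1,\dots,a_n)$, start at $(0,0)$ with $i=n$; read the area vector from left to right, drawing an East step for each entry equal to $-i-1$ and a North step for each entry equal to $-i$; then read it from right to left, drawing an East step for each entry equal to $i+1$ and a North step for each entry equal to $i$; then replace $i$ by $i-1$ and repeat, stopping as soon as $2n$ steps have been drawn; $\zeta_C(\pi)$ is the resulting path. Area of a ballot path $\beta\in\mathcal B_n$: index columns and rows by $1,\dots,2n$ (column $i$ is $[i-1,i]\times\mathbb R$, row $j$ is $\mathbb R\times[j-1,j]$); $\operatorname{area}(\beta)$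 is the number of pairs $(i,j)$ with $1\le i<j$, $i+j\le 2n+1$, such that $\beta$ has at least $j$ North steps and its $j$-th North step has $x$-coordinate at most $i-1$ (i.e. the number of boxes of the staircase region $\{i<j,\ i+j\le 2n+1\}$ lying below/right of $\beta$). -}

module Defs where

open import Data.Nat as ℕ using (ℕ; zero; suc; _≤_; _<_)
open import Data.Integer as ℤ using (ℤ; +_; -_)
open import Data.List using (List; []; _∷_; _++_; length; filterᵇ; map; concat; concatMap; reverse; take; upTo; downFrom; inits)
open import Data.List.Relation.Unary.All using (All)
open import Data.Nat.ListAction using (sum)
open import Data.Bool using (Bool; true; false; if_then_else_)
open import Data.Maybe using (Maybe; just; nothing)
open import Data.Product using (_×_)
open import Relation.Nullary.Decidable using (⌊_⌋; _×-dec_)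
open import Relation.Binary.PropositionalEquality using (_≡_)

-- Steps of a lattice path: N = (0,1), E = (1,0)
data Step : Set where
  N E : Step

countN : List Step → ℕ
countN []      = 0
countN (N ∷ p) = suc (countN p)
countN (E ∷ p) = countN p

countE : List Step → ℕ
countE []      = 0
countE (N ∷ p) = countE p
countE (E ∷ p) = suc (countE p)

InL : ℕ → List Step → Set
InL n π = (countN π ≡ n) × (countE π ≡ n)

-- β ∈ 𝓑_n: 2n steps, never going below the line x = y
-- (every prefix has at least as many N steps as E steps)
InB : ℕ → List Step → Set
InB n β = (length β ≡ n ℕ.+ n) × All (λ q → countE q ≤ countN q) (inits β)

-- type C area vector: a_i = i - b_i, b_i = x-coordinate of the i-th North step
areaVecFrom : ℕ → ℕ → List Step → List ℤ
areaVecFrom r b []      = []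
areaVecFrom r b (N ∷ p) = ((+ suc r) ℤ.- (+ b)) ∷ areaVecFrom (suc r) b p
areaVecFrom r b (E ∷ p) = areaVecFrom r (suc b) p

areaVec : List Step → List ℤ
areaVec = areaVecFrom 0 0

countPairs : (ℤ → ℤ → Bool) → List ℤ → ℕ
countPairs R []       = 0
countPairs R (a ∷ as) = length (filterᵇ (λ b → R a b) as) ℕ.+ countPairs R as

eqB : ℤ → ℤ → Bool
eqB x y = ⌊ x ℤ.≟ y ⌋

dinvVec : List ℤ → ℕ
dinvVec a =
  countPairs (λ x y → eqB x y) a
  ℕ.+ countPairs (λ x y → eqB x (y ℤ.+ ℤ.1ℤ)) a
  ℕ.+ countPairs (λ x y → eqB x (ℤ.- y)) a
  ℕ.+ countPairs (λ x y → eqB x ((ℤ.- y) ℤ.+ ℤ.1ℤ)) a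
  ℕ.+ length (filterᵇ (λ x → eqB x (+ 0)) a)

dinv : List Step → ℕ
dinv π = dinvVec (areaVec π)

leftStep : ℤ → ℤ → List Step
leftStep i a =
  if eqB a ((ℤ.- i) ℤ.- ℤ.1ℤ) then E ∷ []
  else if eqB a (ℤ.- i) then N ∷ [] else []

rightStep : ℤ → ℤ → List Step
rightStep i a =
  if eqB a (i ℤ.+ ℤ.1ℤ) then E ∷ []
  else if eqB a i then N ∷ [] else []

zetaRound : List ℤ → ℕ → List Step
zetaRound as i = concatMap (leftStep (+ i)) as ++ concatMap (rightStep (+ i)) (reverse as)

zetaC : ℕ → List Step → List Step
zetaC n π = take (n ℕ.+ n) (concat (map (zetaRound (areaVec π)) (downFrom (suc n))))

-- x-coordinate of the j-th North step (j ≥ 1), if it exists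
nthNx : ℕ → ℕ → List Step → Maybe ℕ
nthNx b j       []      = nothing
nthNx b zero    _       = nothing
nthNx b (suc zero)    (N ∷ p) = just b
nthNx b (suc (suc j)) (N ∷ p) = nthNx b (suc j) p
nthNx b j       (E ∷ p) = nthNx (suc b) j p

boxBelow : ℕ → List Step → ℕ → ℕ → ℕ
boxBelow n β i j with nthNx 0 j β
... | nothing = 0
... | just x  = if ⌊ (i ℕ.<? j) ×-dec ((i ℕ.+ j) ℕ.≤? suc (n ℕ.+ n)) ×-dec (x ℕ.<? i) ⌋ then 1 else 0

area : ℕ → List Step → ℕ
area n β = sum (map (λ j → sum (map (λ i → boxBelow n β i j) rng)) rng)
  where rng = map suc (upTo (n ℕ.+ n))

module Submission where

open import Defs
open import Data.Nat as ℕ using (ℕ; zero; suc; _+_; _*_; _∸_; _≤_; _<_; z≤n; s≤s; _⊓_; _<?_; _≤?_)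
open import Data.Nat.Properties
open import Data.Nat.ListAction using (sum)
open import Data.Nat.ListAction.Properties using (sum-++)
open import Data.Nat.Tactic.RingSolver using (solve-∀)
open import Data.Integer as ℤ using (ℤ; +_; -[1+_]; ∣_∣)
import Data.Integer.Properties as ℤP
open import Data.List using (List; []; _∷_; _++_; length; map; reverse; replicate; [_]; _∷ʳ_; concat; concatMap; downFrom; take; drop; inits; filterᵇ; upTo; applyUpTo)
open import Data.List.Properties using (map-++; length-++; length-map; ++-assoc; ++-identityʳ; take++drop≡id; length-drop; ∷-injective; reverse-++; unfold-reverse; reverse-involutive; length-reverse; take-all; upTo-∷ʳ; map-cong; map-∘; map-applyUpTo; map-upTo; concatMap-++; concatMap-cong; length-take)
open import Data.List.Relation.Unary.All as All using (All; []; _∷_)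
import Data.List.Relation.Unary.All.Properties as AllP
open import Data.Product using (_×_; _,_; proj₁; proj₂; ∃; Σ)
open import Data.Sum using (inj₁; inj₂)
open import Data.Bool using (Bool; true; false; if_then_else_)
open import Data.Maybe using (Maybe; just; nothing)
open import Function using (_∘_)
open import Data.Empty using (⊥; ⊥-elim)
open import Data.Unit using (⊤; tt)
open import Relation.Nullary using (Dec; yes; no; ¬_)
open import Relation.Nullary.Decidable using (⌊_⌋; _×-dec_)
open import Relation.Nullary.Decidable.Core using (isYes; does; _because_)
open import Relation.Binary.PropositionalEquality using (_≡_; refl; sym; trans; cong; cong₂; subst; subst₂; module ≡-Reasoning)

-- Let a be the type C area vector of π ∈ 𝓛_{n,n}. Round i of ζ_C reads the entries ±i and ±(i+1)
-- of a, the negative ones from the left and the nonnegative ones from the right. Folding a (nonnegative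
-- entries kept in order, each negative entry −m moved to the end as m, each 0 written at both ends)
-- turns every round into a single pass over a sequence h of naturals: ζ_C(π) reversed lists, for
-- i = 0, …, n, an N for each entry i of h and an E for each entry i + 1. Every entry of 0 ∷ h exceeds its
-- predecessor by at most one, so 0 ∷ h is the preorder depth sequence of a plane forest, and the list
-- just described is its breadth-first code: an N for each node followed by an E for each child. A forest
-- is determined by its breadth-first code, the codes of forests of height at most n + 1 are exactly the
-- paths N ∷ reverse β with β a ballot path, and a is recovered from h; so ζ_C is a bijection.
--
-- For the statistics, each pair of entries of h is either near (equal, or the earlier one larger by one)
-- or yields a pair E … N in ζ_C(π); the near pairs number dinv(π) + z(z − 1), where z is the number of
-- zero entries of a. Summing the area of the ballot path β = ζ_C(π) row by row, area(β) plus its pairs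
-- E … N plus the same z(z − 1) is again the number of pairs of N steps of β.

isYes≡does : ∀ {A : Set} (d : Dec A) → isYes d ≡ does d
isYes≡does (true because _) = refl
isYes≡does (false because _) = refl

≡ᵇ-sym : ∀ a b → (a ℕ.≡ᵇ b) ≡ (b ℕ.≡ᵇ a)
≡ᵇ-sym zero zero = refl
≡ᵇ-sym zero (suc b) = refl
≡ᵇ-sym (suc a) zero = refl
≡ᵇ-sym (suc a) (suc b) = ≡ᵇ-sym a b

fromBool : Bool → ℕ
fromBool true = 1
fromBool false = 0

data Even : ℕ → Set where
  even0 : Even 0
  even2 : ∀ {n} → Even n → Even (suc (suc n))

even-double : ∀ k → Even (k + k)
even-double zero = even0
even-double (suc k) = subst Even (cong suc (sym (+-suc k k))) (even2 (even-double k))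

even-difference : ∀ n z L → (n + n) + z ≡ L + L → Even z
even-difference zero z L eq = subst Even (sym eq) (even-double L)
even-difference (suc n) z zero eq with () ← trans (sym eq) refl
even-difference (suc n) z (suc L) eq = even-difference n z L (suc-injective (trans (sym (cong (_+ z) (+-suc n n))) (trans (suc-injective eq) (+-suc L L))))

m+m≡n+n⇒m≡n : ∀ m k → m + m ≡ k + k → m ≡ k
m+m≡n+n⇒m≡n zero zero eq = refl
m+m≡n+n⇒m≡n zero (suc k) ()
m+m≡n+n⇒m≡n (suc m) zero ()
m+m≡n+n⇒m≡n (suc m) (suc k) eq = cong suc (m+m≡n+n⇒m≡n m k (suc-injective (trans (sym (+-suc m m)) (trans (suc-injective eq) (+-suc k k)))))

m+m≤n+n⇒m≤n : ∀ e n → e + e ≤ n + n → e ≤ n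
m+m≤n+n⇒m≤n e n le with ≤-total e n
... | inj₁ p = p
... | inj₂ p with m≤n⇒m<n∨m≡n p
...   | inj₂ refl = ≤-refl
...   | inj₁ lt = ⊥-elim (<⇒≱ (+-mono-< lt lt) le)

indicator : ∀ {P : ℕ → Set} → (∀ i → Dec (P i)) → ℕ → ℕ
indicator d i = if ⌊ d i ⌋ then 1 else 0

count-interval : ∀ {P : ℕ → Set} (d : ∀ i → Dec (P i)) lo hi →
  (∀ i → P i → (lo < i) × (i ≤ hi)) → (∀ i → lo < i → i ≤ hi → P i) →
  ∀ M → sum (map (indicator d) (map suc (upTo M))) ≡ (hi ⊓ M) ∸ lo
count-interval d lo hi to fro zero = trans (sym (0∸n≡0 lo)) (cong (_∸ lo) (sym (⊓-zeroʳ hi)))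
count-interval d lo hi to fro (suc M) = begin
    sum (map (indicator d) (map suc (upTo (suc M))))
      ≡⟨ cong (λ z → sum (map (indicator d) (map suc z))) (sym (upTo-∷ʳ M)) ⟩
    sum (map (indicator d) (map suc (upTo M ∷ʳ M)))
      ≡⟨ cong (λ z → sum (map (indicator d) z)) (map-++ suc (upTo M) (M ∷ [])) ⟩
    sum (map (indicator d) (map suc (upTo M) ++ suc M ∷ []))
      ≡⟨ cong sum (map-++ (indicator d) (map suc (upTo M)) (suc M ∷ [])) ⟩
    sum (map (indicator d) (map suc (upTo M)) ++ indicator d (suc M) ∷ [])
      ≡⟨ sum-++ (map (indicator d) (map suc (upTo M))) (indicator d (suc M) ∷ []) ⟩
    sum (map (indicator d) (map suc (upTo M))) + (indicator d (suc M) + 0)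
      ≡⟨ cong₂ _+_ (count-interval d lo hi to fro M) (+-identityʳ _) ⟩
    (hi ⊓ M) ∸ lo + indicator d (suc M)
      ≡⟨ step ⟩
    (hi ⊓ suc M) ∸ lo ∎
  where
  open ≡-Reasoning
  step : (hi ⊓ M) ∸ lo + indicator d (suc M) ≡ (hi ⊓ suc M) ∸ lo
  step with d (suc M)
  ... | yes p with to (suc M) p
  ...   | s≤s lo≤M , sM≤hi =
          trans (cong (λ z → z ∸ lo + 1) (m≥n⇒m⊓n≡n (≤-trans (n≤1+n M) sM≤hi)))
            (trans (trans (+-comm (M ∸ lo) 1) (sym (+-∸-assoc 1 lo≤M))) (cong (_∸ lo) (sym (m≥n⇒m⊓n≡n sM≤hi))))
  step | no ¬p with suc M ℕ.≤? hi
  ... | no ¬le = trans (+-identityʳ _) (cong (_∸ lo) (trans (m≤n⇒m⊓n≡m hi≤M) (sym (m≤n⇒m⊓n≡m (≤-trans hi≤M (n≤1+n M))))))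
    where hi≤M = ≤-pred (≰⇒> ¬le)
  ... | yes le with lo ℕ.<? suc M
  ...   | yes lt = ⊥-elim (¬p (fro (suc M) lt le))
  ...   | no ¬lt = trans (+-identityʳ _) (trans (m≤n⇒m∸n≡0 (≤-trans (m⊓n≤n hi M) (≤-trans (n≤1+n M) (≤-pred (≰⇒> ¬lt))))) (sym (m≤n⇒m∸n≡0 (≤-trans (m⊓n≤n hi (suc M)) (≤-pred (≰⇒> ¬lt))))))

length-∷ʳ : ∀ {A : Set} (xs : List A) y → length (xs ∷ʳ y) ≡ suc (length xs)
length-∷ʳ [] y = refl
length-∷ʳ (x ∷ xs) y = cong suc (length-∷ʳ xs y)

take-length-++ : ∀ {A : Set} (xs ys : List A) → take (length xs) (xs ++ ys) ≡ xs
take-length-++ [] ys = refl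
take-length-++ (x ∷ xs) ys = cong (x ∷_) (take-length-++ xs ys)

drop-length-++ : ∀ {A : Set} (xs ys : List A) → drop (length xs) (xs ++ ys) ≡ ys
drop-length-++ [] ys = refl
drop-length-++ (x ∷ xs) ys = drop-length-++ xs ys

sumBy : {A : Set} → (A → ℕ) → List A → ℕ
sumBy f [] = 0
sumBy f (y ∷ ys) = f y + sumBy f ys

module _ {A : Set} where

  sumBy-++ : ∀ (f : A → ℕ) xs ys → sumBy f (xs ++ ys) ≡ sumBy f xs + sumBy f ys
  sumBy-++ f [] ys = refl
  sumBy-++ f (x ∷ xs) ys = trans (cong (_+_ (f x)) (sumBy-++ f xs ys)) (sym (+-assoc (f x) _ _))

  sumBy-∷ʳ : ∀ (f : A → ℕ) xs y → sumBy f (xs ∷ʳ y) ≡ sumBy f xs + f y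
  sumBy-∷ʳ f xs y = trans (sumBy-++ f xs (y ∷ [])) (cong (_+_ (sumBy f xs)) (+-identityʳ (f y)))

  sumBy-+ : ∀ (f g : A → ℕ) xs → sumBy (λ y → f y + g y) xs ≡ sumBy f xs + sumBy g xs
  sumBy-+ f g [] = refl
  sumBy-+ f g (x ∷ xs) rewrite sumBy-+ f g xs = +-assoc-swap (f x) (g x) (sumBy f xs) (sumBy g xs)
    where
    +-assoc-swap : ∀ a b c d → a + b + (c + d) ≡ a + c + (b + d)
    +-assoc-swap = solve-∀

  sumBy-cong : ∀ (f g : A → ℕ) → (∀ y → f y ≡ g y) → ∀ xs → sumBy f xs ≡ sumBy g xs
  sumBy-cong f g e [] = refl
  sumBy-cong f g e (x ∷ xs) = cong₂ _+_ (e x) (sumBy-cong f g e xs)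

  sumBy-double : ∀ (f : A → ℕ) xs → sumBy (λ y → 2 * f y) xs ≡ sumBy f xs + sumBy f xs
  sumBy-double f xs = trans (sumBy-cong _ _ (λ y → cong (_+_ (f y)) (+-identityʳ (f y))) xs) (sumBy-+ f f xs)

sum-zero : ∀ {A : Set} (xs : List A) → sum (map (λ _ → 0) xs) ≡ 0
sum-zero [] = refl
sum-zero (x ∷ xs) = sum-zero xs

countN-++ : ∀ xs ys → countN (xs ++ ys) ≡ countN xs + countN ys
countN-++ [] ys = refl
countN-++ (N ∷ xs) ys = cong suc (countN-++ xs ys)
countN-++ (E ∷ xs) ys = countN-++ xs ys

countE-++ : ∀ xs ys → countE (xs ++ ys) ≡ countE xs + countE ys
countE-++ [] ys = refl
countE-++ (N ∷ xs) ys = countE-++ xs ys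
countE-++ (E ∷ xs) ys = cong suc (countE-++ xs ys)

countN-replicate-E : ∀ k → countN (replicate k E) ≡ 0
countN-replicate-E zero = refl
countN-replicate-E (suc k) = countN-replicate-E k

countE-replicate-E : ∀ k → countE (replicate k E) ≡ k
countE-replicate-E zero = refl
countE-replicate-E (suc k) = cong suc (countE-replicate-E k)

countN-reverse : ∀ β → countN (reverse β) ≡ countN β
countN-reverse [] = refl
countN-reverse (x ∷ β) rewrite unfold-reverse x β | countN-++ (reverse β) (x ∷ []) | countN-reverse β = countN-[x] x
  where
  countN-[x] : ∀ x → countN β + countN (x ∷ []) ≡ countN (x ∷ β)
  countN-[x] N = +-comm (countN β) 1
  countN-[x] E = +-identityʳ (countN β)

countE-reverse : ∀ β → countE (reverse β) ≡ countE β
countE-reverse [] = refl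
countE-reverse (x ∷ β) rewrite unfold-reverse x β | countE-++ (reverse β) (x ∷ []) | countE-reverse β = countE-[x] x
  where
  countE-[x] : ∀ x → countE β + countE (x ∷ []) ≡ countE (x ∷ β)
  countE-[x] N = +-identityʳ (countE β)
  countE-[x] E = +-comm (countE β) 1

length≡countN+countE : ∀ β → length β ≡ countN β + countE β
length≡countN+countE [] = refl
length≡countN+countE (N ∷ β) = cong suc (length≡countN+countE β)
length≡countN+countE (E ∷ β) = trans (cong suc (length≡countN+countE β)) (sym (+-suc (countN β) (countE β)))


-- Level sequences and their sweeps

stepAt : ℕ → ℕ → List Step
stepAt zero zero = N ∷ []
stepAt zero (suc zero) = E ∷ []
stepAt zero (suc (suc _)) = []
stepAt (suc i) zero = []
stepAt (suc i) (suc x) = stepAt i x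

round : ℕ → List ℕ → List Step
round i [] = []
round i (x ∷ xs) = stepAt i x ++ round i xs

lower : List ℕ → List ℕ
lower [] = []
lower (zero ∷ xs) = lower xs
lower (suc x ∷ xs) = x ∷ lower xs

-- sweep F xs = round 0 xs ++ round 1 xs ++ ⋯ ++ round (F ∸ 1) xs, see sweep-suc.
sweep : ℕ → List ℕ → List Step
sweep zero xs = []
sweep (suc F) xs = round 0 xs ++ sweep F (lower xs)

zeros : List ℕ → ℕ
zeros [] = 0
zeros (zero ∷ xs) = suc (zeros xs)
zeros (suc _ ∷ xs) = zeros xs

round-++ : ∀ i xs ys → round i (xs ++ ys) ≡ round i xs ++ round i ys
round-++ i [] ys = refl
round-++ i (x ∷ xs) ys = trans (cong (stepAt i x ++_) (round-++ i xs ys)) (sym (++-assoc (stepAt i x) (round i xs) (round i ys)))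

lower-++ : ∀ xs ys → lower (xs ++ ys) ≡ lower xs ++ lower ys
lower-++ [] ys = refl
lower-++ (zero ∷ xs) ys = lower-++ xs ys
lower-++ (suc x ∷ xs) ys = cong (x ∷_) (lower-++ xs ys)

round-suc : ∀ i xs → round (suc i) xs ≡ round i (lower xs)
round-suc i [] = refl
round-suc i (zero ∷ xs) = round-suc i xs
round-suc i (suc x ∷ xs) = cong (stepAt i x ++_) (round-suc i xs)

round0-map-suc : ∀ xs → round 0 (map suc xs) ≡ replicate (zeros xs) E
round0-map-suc [] = refl
round0-map-suc (zero ∷ xs) = cong (E ∷_) (round0-map-suc xs)
round0-map-suc (suc x ∷ xs) = round0-map-suc xs

lower-map-suc : ∀ xs → lower (map suc xs) ≡ xs
lower-map-suc [] = refl
lower-map-suc (x ∷ xs) = cong (x ∷_) (lower-map-suc xs)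

zeros-++ : ∀ xs ys → zeros (xs ++ ys) ≡ zeros xs + zeros ys
zeros-++ [] ys = refl
zeros-++ (zero ∷ xs) ys = cong suc (zeros-++ xs ys)
zeros-++ (suc x ∷ xs) ys = zeros-++ xs ys

zeros-map-suc : ∀ xs → zeros (map suc xs) ≡ 0
zeros-map-suc [] = refl
zeros-map-suc (x ∷ xs) = zeros-map-suc xs

sweep-suc : ∀ m h → sweep (suc m) h ≡ sweep m h ++ round m h
sweep-suc zero h = ++-identityʳ (round 0 h)
sweep-suc (suc m) h = begin
    round 0 h ++ sweep (suc m) (lower h) ≡⟨ cong (round 0 h ++_) (sweep-suc m (lower h)) ⟩
    round 0 h ++ (sweep m (lower h) ++ round m (lower h)) ≡⟨ sym (++-assoc (round 0 h) _ _) ⟩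
    (round 0 h ++ sweep m (lower h)) ++ round m (lower h) ≡⟨ cong ((round 0 h ++ sweep m (lower h)) ++_) (sym (round-suc m h)) ⟩
    sweep (suc m) h ++ round (suc m) h ∎
  where open ≡-Reasoning

length-round0 : ∀ xs → length (round 0 xs) ≡ zeros xs + zeros (lower xs)
length-round0 [] = refl
length-round0 (zero ∷ xs) = cong suc (length-round0 xs)
length-round0 (suc zero ∷ xs) = trans (cong suc (length-round0 xs)) (sym (+-suc (zeros xs) _))
length-round0 (suc (suc x) ∷ xs) = length-round0 xs

length-lower : ∀ xs → length (lower xs) + zeros xs ≡ length xs
length-lower [] = refl
length-lower (zero ∷ xs) = trans (+-suc _ _) (cong suc (length-lower xs))
length-lower (suc x ∷ xs) = cong suc (length-lower xs)

lower-All< : ∀ F xs → All (_< suc F) xs → All (_< F) (lower xs)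
lower-All< F [] _ = []
lower-All< F (zero ∷ xs) (_ ∷ a) = lower-All< F xs a
lower-All< F (suc x ∷ xs) (s≤s p ∷ a) = p ∷ lower-All< F xs a

lower-All<⁻ : ∀ F xs → All (_< F) (lower xs) → All (_< suc F) xs
lower-All<⁻ F [] _ = []
lower-All<⁻ F (zero ∷ xs) a = s≤s z≤n ∷ lower-All<⁻ F xs a
lower-All<⁻ F (suc x ∷ xs) (p ∷ a) = s≤s p ∷ lower-All<⁻ F xs a

length-sweep : ∀ F xs → All (_< F) xs → length (sweep F xs) + zeros xs ≡ length xs + length xs
length-sweep zero [] a = refl
length-sweep zero (x ∷ xs) (() ∷ _)
length-sweep (suc F) xs a = begin
    length (round 0 xs ++ sweep F (lower xs)) + zeros xs
      ≡⟨ cong (_+ zeros xs) (trans (length-++ (round 0 xs)) (cong (_+ length (sweep F (lower xs))) (length-round0 xs))) ⟩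
    (zeros xs + zeros (lower xs)) + length (sweep F (lower xs)) + zeros xs
      ≡⟨ rearrange (zeros xs) (zeros (lower xs)) (length (sweep F (lower xs))) ⟩
    zeros xs + zeros xs + (length (sweep F (lower xs)) + zeros (lower xs))
      ≡⟨ cong (_+_ (zeros xs + zeros xs)) (length-sweep F (lower xs) (lower-All< F xs a)) ⟩
    zeros xs + zeros xs + (length (lower xs) + length (lower xs))
      ≡⟨ rearrange′ (zeros xs) (length (lower xs)) ⟩
    (length (lower xs) + zeros xs) + (length (lower xs) + zeros xs)
      ≡⟨ cong₂ _+_ (length-lower xs) (length-lower xs) ⟩
    length xs + length xs ∎
  where
  open ≡-Reasoning
  rearrange : ∀ z o L → (z + o) + L + z ≡ z + z + (L + o)
  rearrange = solve-∀
  rearrange′ : ∀ z d → z + z + (d + d) ≡ (d + z) + (d + z)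
  rearrange′ = solve-∀


-- Plane forests: preorder depths and breadth-first codes

data Tree : Set where
  node : List Tree → Tree

children : Tree → List Tree
children (node cs) = cs

depths : List Tree → List ℕ
depths [] = []
depths (node cs ∷ ts) = 0 ∷ map suc (depths cs) ++ depths ts

nextLevel : List Tree → List Tree
nextLevel [] = []
nextLevel (t ∷ ts) = children t ++ nextLevel ts

degreeCode : List ℕ → List Step
degreeCode [] = []
degreeCode (k ∷ ks) = N ∷ replicate k E ++ degreeCode ks

degrees : List Tree → List ℕ
degrees ts = map (λ t → length (children t)) ts

bfsCode : ℕ → List Tree → List Step
bfsCode zero ts = []
bfsCode (suc F) ts = degreeCode (degrees ts) ++ bfsCode F (nextLevel ts)

depths-++ : ∀ xs ys → depths (xs ++ ys) ≡ depths xs ++ depths ys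
depths-++ [] ys = refl
depths-++ (node cs ∷ xs) ys = cong (0 ∷_) (trans (cong (map suc (depths cs) ++_) (depths-++ xs ys))
  (sym (++-assoc (map suc (depths cs)) (depths xs) (depths ys))))

zeros-depths : ∀ ts → zeros (depths ts) ≡ length ts
zeros-depths [] = refl
zeros-depths (node cs ∷ ts) = cong suc (trans (zeros-++ (map suc (depths cs)) (depths ts)) (cong₂ _+_ (zeros-map-suc (depths cs)) (zeros-depths ts)))

round0-depths : ∀ ts → round 0 (depths ts) ≡ degreeCode (degrees ts)
round0-depths [] = refl
round0-depths (node cs ∷ ts) = cong (N ∷_) (begin
    round 0 (map suc (depths cs) ++ depths ts) ≡⟨ round-++ 0 (map suc (depths cs)) (depths ts) ⟩
    round 0 (map suc (depths cs)) ++ round 0 (depths ts) ≡⟨ cong₂ _++_ (trans (round0-map-suc (depths cs)) (cong (λ k → replicate k E) (zeros-depths cs))) (round0-depths ts) ⟩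
    replicate (length cs) E ++ degreeCode (degrees ts) ∎)
  where open ≡-Reasoning

lower-depths : ∀ ts → lower (depths ts) ≡ depths (nextLevel ts)
lower-depths [] = refl
lower-depths (node cs ∷ ts) = begin
    lower (map suc (depths cs) ++ depths ts) ≡⟨ lower-++ (map suc (depths cs)) (depths ts) ⟩
    lower (map suc (depths cs)) ++ lower (depths ts) ≡⟨ cong₂ _++_ (lower-map-suc (depths cs)) (lower-depths ts) ⟩
    depths cs ++ depths (nextLevel ts) ≡⟨ sym (depths-++ cs (nextLevel ts)) ⟩
    depths (cs ++ nextLevel ts) ∎
  where open ≡-Reasoning

sweep-depths : ∀ F ts → sweep F (depths ts) ≡ bfsCode F ts
sweep-depths zero ts = refl
sweep-depths (suc F) ts = cong₂ _++_ (round0-depths ts) (trans (cong (sweep F) (lower-depths ts)) (sweep-depths F (nextLevel ts)))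

Height≤ : ℕ → List Tree → Set
Height≤ zero ts = ts ≡ []
Height≤ (suc F) ts = Height≤ F (nextLevel ts)

Height≤-[] : ∀ F → Height≤ F []
Height≤-[] zero = refl
Height≤-[] (suc F) = Height≤-[] F

bfsCode-[] : ∀ F → bfsCode F [] ≡ []
bfsCode-[] zero = refl
bfsCode-[] (suc F) = bfsCode-[] F

All<⇒Height≤ : ∀ F ts → All (_< F) (depths ts) → Height≤ F ts
All<⇒Height≤ zero [] a = refl
All<⇒Height≤ zero (node cs ∷ ts) (() ∷ _)
All<⇒Height≤ (suc F) ts a = All<⇒Height≤ F (nextLevel ts) (subst (All (_< F)) (lower-depths ts) (lower-All< F (depths ts) a))

Height≤⇒All< : ∀ F ts → Height≤ F ts → All (_< F) (depths ts)
Height≤⇒All< zero ts hb rewrite hb = []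
Height≤⇒All< (suc F) ts hb = lower-All<⁻ F (depths ts) (subst (All (_< F)) (sym (lower-depths ts)) (Height≤⇒All< F (nextLevel ts) hb))

countN-degreeCode : ∀ ks → countN (degreeCode ks) ≡ length ks
countN-degreeCode [] = refl
countN-degreeCode (k ∷ ks) = cong suc (trans (countN-++ (replicate k E) (degreeCode ks)) (cong₂ _+_ (countN-replicate-E k) (countN-degreeCode ks)))

countE-degreeCode : ∀ ks → countE (degreeCode ks) ≡ sum ks
countE-degreeCode [] = refl
countE-degreeCode (k ∷ ks) = trans (countE-++ (replicate k E) (degreeCode ks)) (cong₂ _+_ (countE-replicate-E k) (countE-degreeCode ks))

length-nextLevel : ∀ ts → length (nextLevel ts) ≡ sum (degrees ts)
length-nextLevel [] = refl
length-nextLevel (t ∷ ts) = trans (length-++ (children t)) (cong (_+_ (length (children t))) (length-nextLevel ts))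

bfsCode-count : ∀ F ts → Height≤ F ts → length ts + countE (bfsCode F ts) ≡ countN (bfsCode F ts)
bfsCode-count zero ts hb rewrite hb = refl
bfsCode-count (suc F) ts hb = begin
    length ts + countE (degreeCode (degrees ts) ++ bfsCode F (nextLevel ts))
      ≡⟨ cong (_+_ (length ts)) (trans (countE-++ (degreeCode (degrees ts)) _) (cong (_+ countE (bfsCode F (nextLevel ts))) (trans (countE-degreeCode (degrees ts)) (sym (length-nextLevel ts))))) ⟩
    length ts + (length (nextLevel ts) + countE (bfsCode F (nextLevel ts)))
      ≡⟨ cong (_+_ (length ts)) (bfsCode-count F (nextLevel ts) hb) ⟩
    length ts + countN (bfsCode F (nextLevel ts))
      ≡⟨ cong (_+ countN (bfsCode F (nextLevel ts))) (trans (sym (length-map (λ t → length (children t)) ts)) (sym (countN-degreeCode (degrees ts)))) ⟩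
    countN (degreeCode (degrees ts)) + countN (bfsCode F (nextLevel ts))
      ≡⟨ sym (countN-++ (degreeCode (degrees ts)) _) ⟩
    countN (degreeCode (degrees ts) ++ bfsCode F (nextLevel ts)) ∎
  where open ≡-Reasoning

bfsCode-fuel : ∀ F G ts → Height≤ F ts → Height≤ G ts → bfsCode F ts ≡ bfsCode G ts
bfsCode-fuel zero G ts h1 h2 rewrite h1 = sym (bfsCode-[] G)
bfsCode-fuel (suc F) zero ts h1 h2 rewrite h2 = bfsCode-[] (suc F)
bfsCode-fuel (suc F) (suc G) ts h1 h2 = cong (degreeCode (degrees ts) ++_) (bfsCode-fuel F G (nextLevel ts) h1 h2)

Height≤-countE : ∀ m F ts → Height≤ F ts → countE (bfsCode F ts) ≤ m → Height≤ (suc m) ts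
Height≤-countE m zero ts hb le rewrite hb = Height≤-[] m
Height≤-countE m (suc F) ts hb le = levels≤ m (nextLevel ts) hb le2
  where
  le2 : length (nextLevel ts) + countE (bfsCode F (nextLevel ts)) ≤ m
  le2 = subst (_≤ m) (trans (countE-++ (degreeCode (degrees ts)) _) (cong (_+ countE (bfsCode F (nextLevel ts))) (trans (countE-degreeCode (degrees ts)) (sym (length-nextLevel ts))))) le
  levels≤ : ∀ m ks → Height≤ F ks → length ks + countE (bfsCode F ks) ≤ m → Height≤ m ks
  levels≤ m [] _ _ = Height≤-[] m
  levels≤ zero (k ∷ ks) _ ()
  levels≤ (suc m) (k ∷ ks) hb le = Height≤-countE m F (k ∷ ks) hb (≤-pred (≤-trans (s≤s (m≤n+m _ (length ks))) le))

Rising : ℕ → List ℕ → Set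
Rising p [] = ⊤
Rising p (x ∷ xs) = (x ≤ suc p) × Rising x xs

DepthSeq : List ℕ → Set
DepthSeq [] = ⊤
DepthSeq (zero ∷ t) = Rising 0 t
DepthSeq (suc _ ∷ t) = ⊥

Rising-map-suc : ∀ p xs → Rising p xs → Rising (suc p) (map suc xs)
Rising-map-suc p [] u = tt
Rising-map-suc p (x ∷ xs) (le , u) = s≤s le , Rising-map-suc x xs u

Rising-++ : ∀ p xs ys → Rising p xs → DepthSeq ys → Rising p (xs ++ ys)
Rising-++ p [] [] u f = tt
Rising-++ p [] (zero ∷ ys) u f = z≤n , f
Rising-++ p [] (suc y ∷ ys) u ()
Rising-++ p (x ∷ xs) ys (le , u) f = le , Rising-++ x xs ys u f

DepthSeq-depths : ∀ ts → DepthSeq (depths ts)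
DepthSeq-depths [] = tt
DepthSeq-depths (node cs ∷ ts) = Rising-++ 0 (map suc (depths cs)) (depths ts) (Rising-shift (depths cs) (DepthSeq-depths cs)) (DepthSeq-depths ts)
  where
  Rising-shift : ∀ ys → DepthSeq ys → Rising 0 (map suc ys)
  Rising-shift [] _ = tt
  Rising-shift (zero ∷ ys) f = s≤s z≤n , Rising-map-suc 0 ys f
  Rising-shift (suc y ∷ ys) ()

spanPos : List ℕ → List ℕ × List ℕ
spanPos [] = ([] , [])
spanPos (zero ∷ xs) = ([] , zero ∷ xs)
spanPos (suc x ∷ xs) = (x ∷ proj₁ (spanPos xs) , proj₂ (spanPos xs))

spanPos-split : ∀ xs → map suc (proj₁ (spanPos xs)) ++ proj₂ (spanPos xs) ≡ xs
spanPos-split [] = refl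
spanPos-split (zero ∷ xs) = refl
spanPos-split (suc x ∷ xs) = cong (suc x ∷_) (spanPos-split xs)

spanPos-length : ∀ xs → (length (proj₁ (spanPos xs)) ≤ length xs) × (length (proj₂ (spanPos xs)) ≤ length xs)
spanPos-length [] = z≤n , z≤n
spanPos-length (zero ∷ xs) = z≤n , ≤-refl
spanPos-length (suc x ∷ xs) = s≤s (proj₁ (spanPos-length xs)) , m≤n⇒m≤1+n (proj₂ (spanPos-length xs))

spanPos-Rising : ∀ q xs → Rising (suc q) xs → Rising q (proj₁ (spanPos xs)) × DepthSeq (proj₂ (spanPos xs))
spanPos-Rising q [] u = tt , tt
spanPos-Rising q (zero ∷ xs) (_ , u) = tt , u
spanPos-Rising q (suc x ∷ xs) (s≤s le , u) = (le , proj₁ (spanPos-Rising x xs u)) , proj₂ (spanPos-Rising x xs u)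

spanPos-DepthSeq : ∀ xs → Rising 0 xs → DepthSeq (proj₁ (spanPos xs)) × DepthSeq (proj₂ (spanPos xs))
spanPos-DepthSeq [] u = tt , tt
spanPos-DepthSeq (zero ∷ xs) (_ , u) = tt , u
spanPos-DepthSeq (suc zero ∷ xs) (_ , u) = spanPos-Rising 0 xs u
spanPos-DepthSeq (suc (suc x) ∷ xs) (s≤s () , u)

forestOf : ℕ → List ℕ → List Tree
forestOf zero _ = []
forestOf (suc F) [] = []
forestOf (suc F) (zero ∷ xs) = node (forestOf F (proj₁ (spanPos xs))) ∷ forestOf F (proj₂ (spanPos xs))
forestOf (suc F) (suc _ ∷ xs) = []

depths-forestOf : ∀ F xs → length xs ≤ F → DepthSeq xs → depths (forestOf F xs) ≡ xs
depths-forestOf zero [] le f = refl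
depths-forestOf (suc F) [] le f = refl
depths-forestOf (suc F) (zero ∷ xs) (s≤s le) f =
  cong (0 ∷_) (trans (cong₂ (λ a b → map suc a ++ b)
     (depths-forestOf F (proj₁ (spanPos xs)) (≤-trans (proj₁ (spanPos-length xs)) le) (proj₁ (spanPos-DepthSeq xs f)))
     (depths-forestOf F (proj₂ (spanPos xs)) (≤-trans (proj₂ (spanPos-length xs)) le) (proj₂ (spanPos-DepthSeq xs f))))
   (spanPos-split xs))


-- Decoding breadth-first codes

-- w read as queue operations (E pushes, N pops) takes a queue of length q to one of length t
-- without ever popping from an empty queue.
QueueRun : ℕ → List Step → ℕ → Set
QueueRun q [] t = q ≡ t
QueueRun q (E ∷ w) t = QueueRun (suc q) w t
QueueRun zero (N ∷ w) t = ⊥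
QueueRun (suc q) (N ∷ w) t = QueueRun q w t

Queue : ℕ → List Step → Set
Queue q w = QueueRun q w 0

QueueRun-++⁺ : ∀ q xs ys m t → QueueRun q xs m → QueueRun m ys t → QueueRun q (xs ++ ys) t
QueueRun-++⁺ q [] ys m t refl g2 = g2
QueueRun-++⁺ q (E ∷ xs) ys m t g1 g2 = QueueRun-++⁺ (suc q) xs ys m t g1 g2
QueueRun-++⁺ zero (N ∷ xs) ys m t () g2
QueueRun-++⁺ (suc q) (N ∷ xs) ys m t g1 g2 = QueueRun-++⁺ q xs ys m t g1 g2

QueueRun-++⁻ : ∀ q xs ys t → QueueRun q (xs ++ ys) t → Σ ℕ (λ m → QueueRun q xs m × QueueRun m ys t)
QueueRun-++⁻ q [] ys t g = q , refl , g
QueueRun-++⁻ q (E ∷ xs) ys t g = QueueRun-++⁻ (suc q) xs ys t g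
QueueRun-++⁻ zero (N ∷ xs) ys t ()
QueueRun-++⁻ (suc q) (N ∷ xs) ys t g = QueueRun-++⁻ q xs ys t g

QueueRun-replicate-E : ∀ k q w t → QueueRun (k + q) w t → QueueRun q (replicate k E ++ w) t
QueueRun-replicate-E zero q w t g = g
QueueRun-replicate-E (suc k) q w t g = QueueRun-replicate-E k (suc q) w t (subst (λ z → QueueRun z w t) (sym (+-suc k q)) g)

QueueRun-degreeCode : ∀ ks m w t → QueueRun (sum ks + m) w t → QueueRun (length ks + m) (degreeCode ks ++ w) t
QueueRun-degreeCode [] m w t g = g
QueueRun-degreeCode (k ∷ ks) m w t g = subst (λ z → QueueRun (length ks + m) z t) (sym (++-assoc (replicate k E) (degreeCode ks) w))
  (QueueRun-replicate-E k (length ks + m) (degreeCode ks ++ w) t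
    (subst (λ z → QueueRun z (degreeCode ks ++ w) t) e (QueueRun-degreeCode ks (k + m) w t (subst (λ z → QueueRun z w t) rearrange₂ g))))
  where
  e : length ks + (k + m) ≡ k + (length ks + m)
  e = trans (sym (+-assoc (length ks) k m)) (trans (cong (_+ m) (+-comm (length ks) k)) (+-assoc k (length ks) m))
  rearrange₂ : k + sum ks + m ≡ sum ks + (k + m)
  rearrange₂ = trans (cong (_+ m) (+-comm k (sum ks))) (+-assoc (sum ks) k m)

QueueRun-bfsCode : ∀ F ts → Height≤ F ts → QueueRun (length ts) (bfsCode F ts) 0
QueueRun-bfsCode zero ts hb rewrite hb = refl
QueueRun-bfsCode (suc F) ts hb = subst (λ z → QueueRun z (bfsCode (suc F) ts) 0) (trans (+-identityʳ _) (length-map (λ t → length (children t)) ts))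
  (QueueRun-degreeCode (degrees ts) 0 (bfsCode F (nextLevel ts)) 0 (subst (λ z → QueueRun z (bfsCode F (nextLevel ts)) 0) (trans (length-nextLevel ts) (sym (+-identityʳ _))) (QueueRun-bfsCode F (nextLevel ts) hb)))

Queue-replicate-E : ∀ k q w → Queue q (replicate k E ++ w) → Queue (k + q) w
Queue-replicate-E zero q w g = g
Queue-replicate-E (suc k) q w g = subst (λ z → Queue z w) (+-suc k q) (Queue-replicate-E k (suc q) w g)

NoLeadingE : List Step → Set
NoLeadingE [] = ⊤
NoLeadingE (N ∷ _) = ⊤
NoLeadingE (E ∷ _) = ⊥

leadingEs : List Step → ℕ × List Step
leadingEs [] = (0 , [])
leadingEs (N ∷ w) = (0 , N ∷ w)
leadingEs (E ∷ w) = (suc (proj₁ (leadingEs w)) , proj₂ (leadingEs w))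

readDegrees : ℕ → List Step → List ℕ × List Step
readDegrees zero w = ([] , w)
readDegrees (suc r) (N ∷ w) =
  (proj₁ (leadingEs w) ∷ proj₁ (readDegrees r (proj₂ (leadingEs w))) , proj₂ (readDegrees r (proj₂ (leadingEs w))))
readDegrees (suc r) _ = ([] , [])

chunksOf : List ℕ → List Tree → List (List Tree)
chunksOf [] ts = []
chunksOf (k ∷ ks) ts = take k ts ∷ chunksOf ks (drop k ts)

bfsDecode : ℕ → ℕ → List Step → List Tree
bfsDecode zero r w = []
bfsDecode (suc F) r w =
  map node (chunksOf (proj₁ (readDegrees r w)) (bfsDecode F (sum (proj₁ (readDegrees r w))) (proj₂ (readDegrees r w))))

leadingEs-replicate : ∀ k w → NoLeadingE w → leadingEs (replicate k E ++ w) ≡ (k , w)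
leadingEs-replicate zero [] _ = refl
leadingEs-replicate zero (N ∷ w) _ = refl
leadingEs-replicate (suc k) w ns rewrite leadingEs-replicate k w ns = refl

NoLeadingE-bfsCode : ∀ F ts → NoLeadingE (bfsCode F ts)
NoLeadingE-bfsCode zero ts = tt
NoLeadingE-bfsCode (suc F) [] rewrite bfsCode-[] F = tt
NoLeadingE-bfsCode (suc F) (t ∷ ts) = tt

NoLeadingE-degreeCode : ∀ ks w → NoLeadingE w → NoLeadingE (degreeCode ks ++ w)
NoLeadingE-degreeCode [] w ns = ns
NoLeadingE-degreeCode (_ ∷ _) w ns = tt

readDegrees-degreeCode : ∀ ks w → NoLeadingE w → readDegrees (length ks) (degreeCode ks ++ w) ≡ (ks , w)
readDegrees-degreeCode [] w ns = refl
readDegrees-degreeCode (k ∷ ks) w ns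
  rewrite ++-assoc (replicate k E) (degreeCode ks) w
        | leadingEs-replicate k (degreeCode ks ++ w) (NoLeadingE-degreeCode ks w ns)
        | readDegrees-degreeCode ks w ns = refl

chunksOf-degrees : ∀ ts → chunksOf (degrees ts) (nextLevel ts) ≡ map children ts
chunksOf-degrees [] = refl
chunksOf-degrees (t ∷ ts) = cong₂ _∷_ (take-length-++ (children t) (nextLevel ts))
  (trans (cong (chunksOf (degrees ts)) (drop-length-++ (children t) (nextLevel ts))) (chunksOf-degrees ts))

map-node-children : ∀ ts → map node (map children ts) ≡ ts
map-node-children [] = refl
map-node-children (node cs ∷ ts) = cong (node cs ∷_) (map-node-children ts)

bfsDecode-bfsCode : ∀ F ts → Height≤ F ts → bfsDecode F (length ts) (bfsCode F ts) ≡ ts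
bfsDecode-bfsCode zero ts hb = sym hb
bfsDecode-bfsCode (suc F) ts hb = begin
    bfsDecode (suc F) (length ts) (degreeCode (degrees ts) ++ bfsCode F (nextLevel ts))
      ≡⟨ cong (λ r → bfsDecode (suc F) r (degreeCode (degrees ts) ++ bfsCode F (nextLevel ts))) (sym (length-map (λ t → length (children t)) ts)) ⟩
    bfsDecode (suc F) (length (degrees ts)) (degreeCode (degrees ts) ++ bfsCode F (nextLevel ts))
      ≡⟨ cong (λ p → map node (chunksOf (proj₁ p) (bfsDecode F (sum (proj₁ p)) (proj₂ p)))) (readDegrees-degreeCode (degrees ts) (bfsCode F (nextLevel ts)) (NoLeadingE-bfsCode F (nextLevel ts))) ⟩
    map node (chunksOf (degrees ts) (bfsDecode F (sum (degrees ts)) (bfsCode F (nextLevel ts))))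
      ≡⟨ cong (λ r → map node (chunksOf (degrees ts) (bfsDecode F r (bfsCode F (nextLevel ts))))) (sym (length-nextLevel ts)) ⟩
    map node (chunksOf (degrees ts) (bfsDecode F (length (nextLevel ts)) (bfsCode F (nextLevel ts))))
      ≡⟨ cong (λ z → map node (chunksOf (degrees ts) z)) (bfsDecode-bfsCode F (nextLevel ts) hb) ⟩
    map node (chunksOf (degrees ts) (nextLevel ts))
      ≡⟨ cong (map node) (chunksOf-degrees ts) ⟩
    map node (map children ts)
      ≡⟨ map-node-children ts ⟩
    ts ∎
  where open ≡-Reasoning

leadingEs-split : ∀ w → w ≡ replicate (proj₁ (leadingEs w)) E ++ proj₂ (leadingEs w)
leadingEs-split [] = refl
leadingEs-split (N ∷ w) = refl
leadingEs-split (E ∷ w) = cong (E ∷_) (leadingEs-split w)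

leadingEs-NoLeadingE : ∀ w → NoLeadingE (proj₂ (leadingEs w))
leadingEs-NoLeadingE [] = tt
leadingEs-NoLeadingE (N ∷ w) = tt
leadingEs-NoLeadingE (E ∷ w) = leadingEs-NoLeadingE w

record DegreeReading (r m : ℕ) (w : List Step) : Set where
  field
    splits  : w ≡ degreeCode (proj₁ (readDegrees r w)) ++ proj₂ (readDegrees r w)
    count  : length (proj₁ (readDegrees r w)) ≡ r
    queue  : Queue (sum (proj₁ (readDegrees r w)) + m) (proj₂ (readDegrees r w))
    rest : NoLeadingE (proj₂ (readDegrees r w))

readDegrees-sound : ∀ r m w → Queue (r + m) w → NoLeadingE w → DegreeReading r m w
readDegrees-sound zero m w g ns = record { splits = refl ; count = refl ; queue = g ; rest = ns }
readDegrees-sound (suc r) m [] () ns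
readDegrees-sound (suc r) m (E ∷ w) g ()
readDegrees-sound (suc r) m (N ∷ w) g ns = record
  { splits = cong (N ∷_) (trans (leadingEs-split w) (trans (cong (replicate k E ++_) (DegreeReading.splits ih)) (sym (++-assoc (replicate k E) _ _))))
  ; count = cong suc (DegreeReading.count ih)
  ; queue = subst (λ z → Queue z (proj₂ (readDegrees r w1))) (trans (sym (+-assoc (sum ks') k m)) (cong (_+ m) (+-comm (sum ks') k))) (DegreeReading.queue ih)
  ; rest = DegreeReading.rest ih }
  where
  k = proj₁ (leadingEs w)
  w1 = proj₂ (leadingEs w)
  g1 : Queue (k + (r + m)) w1
  g1 = Queue-replicate-E k (r + m) w1 (subst (Queue (r + m)) (leadingEs-split w) g)
  ih : DegreeReading r (k + m) w1
  ih = readDegrees-sound r (k + m) w1 (subst (λ z → Queue z w1) (trans (sym (+-assoc k r m)) (trans (cong (_+ m) (+-comm k r)) (+-assoc r k m))) g1) (leadingEs-NoLeadingE w)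
  ks' = proj₁ (readDegrees r w1)

chunksOf-sound : ∀ ks ts' → length ts' ≡ sum ks →
  (degrees (map node (chunksOf ks ts')) ≡ ks) × (nextLevel (map node (chunksOf ks ts')) ≡ ts') × (length (chunksOf ks ts') ≡ length ks)
chunksOf-sound [] [] eq = refl , refl , refl
chunksOf-sound [] (_ ∷ _) ()
chunksOf-sound (k ∷ ks) ts' eq =
  cong₂ _∷_ (trans (length-take k ts') (m≤n⇒m⊓n≡m kle)) (proj₁ ih) ,
  trans (cong (take k ts' ++_) (proj₁ (proj₂ ih))) (take++drop≡id k ts') ,
  cong suc (proj₂ (proj₂ ih))
  where
  kle : k ≤ length ts'
  kle = subst (k ≤_) (sym eq) (m≤m+n k (sum ks))
  ih = chunksOf-sound ks (drop k ts') (trans (length-drop k ts') (trans (cong (_∸ k) eq) (m+n∸m≡n k (sum ks))))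

Queue-0 : ∀ w → Queue 0 w → NoLeadingE w → w ≡ []
Queue-0 [] g ns = refl
Queue-0 (N ∷ w) () ns
Queue-0 (E ∷ w) g ()

record BfsDecoding (F r : ℕ) (w : List Step) : Set where
  field
    encodes : bfsCode F (bfsDecode F r w) ≡ w
    roots : length (bfsDecode F r w) ≡ r
    height : Height≤ F (bfsDecode F r w)

bfsDecode-sound : ∀ F r w → countN w ≤ F → Queue r w → NoLeadingE w → BfsDecoding F r w
bfsDecode-sound zero r [] le g ns = record { encodes = refl ; roots = sym g ; height = refl }
bfsDecode-sound zero r (N ∷ w) () g ns
bfsDecode-sound zero r (E ∷ w) le g ()
bfsDecode-sound (suc F) zero w le g ns rewrite Queue-0 w g ns = record { encodes = bfsCode-[] F ; roots = refl ; height = Height≤-[] F }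
bfsDecode-sound (suc F) (suc r) w le g ns = record
  { encodes = trans (cong₂ _++_ (cong degreeCode (proj₁ co)) (trans (cong (bfsCode F) (proj₁ (proj₂ co))) (BfsDecoding.encodes ih))) (sym (DegreeReading.splits B))
  ; roots = trans (length-map node (chunksOf ks ts')) (trans (proj₂ (proj₂ co)) (DegreeReading.count B))
  ; height = subst (Height≤ F) (sym (proj₁ (proj₂ co))) (BfsDecoding.height ih) }
  where
  B : DegreeReading (suc r) 0 w
  B = readDegrees-sound (suc r) 0 w (subst (λ z → Queue z w) (sym (+-identityʳ (suc r))) g) ns
  ks = proj₁ (readDegrees (suc r) w)
  w' = proj₂ (readDegrees (suc r) w)
  cnt : countN w ≡ suc r + countN w'
  cnt = trans (cong countN (DegreeReading.splits B)) (trans (countN-++ (degreeCode ks) w') (cong (_+ countN w') (trans (countN-degreeCode ks) (DegreeReading.count B))))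
  le' : countN w' ≤ F
  le' = ≤-pred (≤-trans (s≤s (m≤n+m (countN w') r)) (subst (_≤ suc F) cnt le))
  ih : BfsDecoding F (sum ks) w'
  ih = bfsDecode-sound F (sum ks) w' le' (subst (λ z → Queue z w') (+-identityʳ (sum ks)) (DegreeReading.queue B)) (DegreeReading.rest B)
  ts' = bfsDecode F (sum ks) w'
  co = chunksOf-sound ks ts' (BfsDecoding.roots ih)


-- Ballot paths

Ballot : ℕ → List Step → ℕ → Set
Ballot c [] t = c ≡ t
Ballot c (N ∷ β) t = Ballot (suc c) β t
Ballot zero (E ∷ β) t = ⊥
Ballot (suc c) (E ∷ β) t = Ballot c β t

QueueRun-reverse⇒Ballot : ∀ q β t → QueueRun q (reverse β) t → Ballot t β q
QueueRun-reverse⇒Ballot q [] t g = sym g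
QueueRun-reverse⇒Ballot q (x ∷ β) t g rewrite unfold-reverse x β with QueueRun-++⁻ q (reverse β) (x ∷ []) t g
QueueRun-reverse⇒Ballot q (N ∷ β) t g | suc m , g1 , refl = QueueRun-reverse⇒Ballot q β (suc m) g1
QueueRun-reverse⇒Ballot q (E ∷ β) t g | m , g1 , refl = QueueRun-reverse⇒Ballot q β m g1

Ballot⇒QueueRun-reverse : ∀ q β t → Ballot t β q → QueueRun q (reverse β) t
Ballot⇒QueueRun-reverse q [] t b = sym b
Ballot⇒QueueRun-reverse q (N ∷ β) t b rewrite unfold-reverse N β = QueueRun-++⁺ q (reverse β) (N ∷ []) (suc t) t (Ballot⇒QueueRun-reverse q β (suc t) b) refl
Ballot⇒QueueRun-reverse q (E ∷ β) zero ()
Ballot⇒QueueRun-reverse q (E ∷ β) (suc t) b rewrite unfold-reverse E β = QueueRun-++⁺ q (reverse β) (E ∷ []) t (suc t) (Ballot⇒QueueRun-reverse q β t b) refl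

Ballot-count : ∀ c β t → Ballot c β t → c + countN β ≡ t + countE β
Ballot-count c [] t b = trans (+-identityʳ c) (trans b (sym (+-identityʳ t)))
Ballot-count c (N ∷ β) t b = trans (+-suc c (countN β)) (Ballot-count (suc c) β t b)
Ballot-count zero (E ∷ β) t ()
Ballot-count (suc c) (E ∷ β) t b = trans (cong suc (Ballot-count c β t b)) (sym (+-suc t (countE β)))

Ballot⇒inits : ∀ c β t → Ballot c β t → All (λ p → countE p ≤ c + countN p) (inits β)
Ballot⇒inits c [] t b = z≤n ∷ []
Ballot⇒inits c (N ∷ β) t b = z≤n ∷ AllP.map⁺ (All.map (λ {p} le → ≤-trans le (≤-reflexive (sym (+-suc c (countN p))))) (Ballot⇒inits (suc c) β t b))
Ballot⇒inits zero (E ∷ β) t ()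
Ballot⇒inits (suc c) (E ∷ β) t b = z≤n ∷ AllP.map⁺ (All.map s≤s (Ballot⇒inits c β t b))

inits⇒Ballot : ∀ c β → All (λ p → countE p ≤ c + countN p) (inits β) → Σ ℕ (λ t → Ballot c β t)
inits⇒Ballot c [] a = c , refl
inits⇒Ballot c (N ∷ β) (_ ∷ a) = inits⇒Ballot (suc c) β (All.map (λ {p} le → ≤-trans le (≤-reflexive (+-suc c (countN p)))) (AllP.map⁻ a))
inits⇒Ballot zero (E ∷ β) (_ ∷ (() ∷ _))
inits⇒Ballot (suc c) (E ∷ β) (_ ∷ a) = inits⇒Ballot c β (All.map (λ { (s≤s le) → le }) (AllP.map⁻ a))


-- Area sequences

-- m ⊖ n by structural recursion (diff≡⊖).
diff : ℕ → ℕ → ℤ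
diff m zero = + m
diff zero (suc n) = -[1+ n ]
diff (suc m) (suc n) = diff m n

diff≡⊖ : ∀ m n → diff m n ≡ m ℤ.⊖ n
diff≡⊖ m zero = refl
diff≡⊖ zero (suc n) = refl
diff≡⊖ (suc m) (suc n) = trans (diff≡⊖ m n) (sym (ℤP.[1+m]⊖[1+n]≡m⊖n m n))

-≡diff : ∀ m n → (+ m) ℤ.- (+ n) ≡ diff m n
-≡diff m n = trans (ℤP.m-n≡m⊖n m n) (sym (diff≡⊖ m n))

Rise≤1 : ℤ → ℤ → Set
Rise≤1 (+ p) (+ v) = v ≤ suc p
Rise≤1 (+ p) -[1+ v ] = ⊤
Rise≤1 -[1+ p ] (+ v) = (v ≡ 0) × (p ≡ 0)
Rise≤1 -[1+ p ] -[1+ v ] = p ≤ suc v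

NonNeg : ℤ → Set
NonNeg (+ _) = ⊤
NonNeg -[1+ _ ] = ⊥

Admissible : ℤ → List ℤ → Set
Admissible p [] = NonNeg p
Admissible p (v ∷ a) = Rise≤1 p v × Admissible v a

-- The area vector of p drawn from the point (b, r).
areaSeq : ℕ → ℕ → List Step → List ℤ
areaSeq r b [] = []
areaSeq r b (N ∷ p) = diff (suc r) b ∷ areaSeq (suc r) b p
areaSeq r b (E ∷ p) = areaSeq r (suc b) p

areaVecFrom≡areaSeq : ∀ r b p → areaVecFrom r b p ≡ areaSeq r b p
areaVecFrom≡areaSeq r b [] = refl
areaVecFrom≡areaSeq r b (N ∷ p) = cong₂ _∷_ (-≡diff (suc r) b) (areaVecFrom≡areaSeq (suc r) b p)
areaVecFrom≡areaSeq r b (E ∷ p) = areaVecFrom≡areaSeq r (suc b) p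

length-areaSeq : ∀ r b p → length (areaSeq r b p) ≡ countN p
length-areaSeq r b [] = refl
length-areaSeq r b (N ∷ p) = cong suc (length-areaSeq (suc r) b p)
length-areaSeq r b (E ∷ p) = length-areaSeq r (suc b) p

Rise≤1-weaken : ∀ r b v → Rise≤1 (diff r (suc b)) v → Rise≤1 (diff r b) v
Rise≤1-weaken zero zero (+ x) (refl , _) = z≤n
Rise≤1-weaken zero zero -[1+ x ] _ = tt
Rise≤1-weaken zero (suc b) (+ x) (_ , ())
Rise≤1-weaken zero (suc b) -[1+ x ] le = ≤-trans (n≤1+n b) le
Rise≤1-weaken (suc r) zero (+ x) le = m≤n⇒m≤1+n le
Rise≤1-weaken (suc r) zero -[1+ x ] _ = tt
Rise≤1-weaken (suc r) (suc b) v le = Rise≤1-weaken r b v le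

NonNeg-weaken : ∀ r b → NonNeg (diff r (suc b)) → NonNeg (diff r b)
NonNeg-weaken zero zero ()
NonNeg-weaken zero (suc b) ()
NonNeg-weaken (suc r) zero _ = tt
NonNeg-weaken (suc r) (suc b) n = NonNeg-weaken r b n

Admissible-weaken : ∀ r b a → Admissible (diff r (suc b)) a → Admissible (diff r b) a
Admissible-weaken r b [] n = NonNeg-weaken r b n
Admissible-weaken r b (v ∷ a) (l , x) = Rise≤1-weaken r b v l , x

Rise≤1-diff-suc : ∀ r b → Rise≤1 (diff r b) (diff (suc r) b)
Rise≤1-diff-suc r zero = ≤-refl
Rise≤1-diff-suc zero (suc zero) = refl , refl
Rise≤1-diff-suc zero (suc (suc b)) = ≤-refl
Rise≤1-diff-suc (suc r) (suc b) = Rise≤1-diff-suc r b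

NonNeg-diff : ∀ r b → b ≤ r → NonNeg (diff r b)
NonNeg-diff r zero _ = tt
NonNeg-diff (suc r) (suc b) (s≤s le) = NonNeg-diff r b le

areaSeq-Admissible : ∀ r b π → b + countE π ≤ r + countN π → Admissible (diff r b) (areaSeq r b π)
areaSeq-Admissible r b [] le = NonNeg-diff r b (subst₂ _≤_ (+-identityʳ b) (+-identityʳ r) le)
areaSeq-Admissible r b (N ∷ p) le = Rise≤1-diff-suc r b , areaSeq-Admissible (suc r) b p (subst (b + countE p ≤_) (+-suc r (countN p)) le)
areaSeq-Admissible r b (E ∷ p) le = Admissible-weaken r b (areaSeq r (suc b) p) (areaSeq-Admissible r (suc b) p (subst (_≤ r + countN p) (+-suc b (countE p)) le))

diff-pos : ∀ r b m → diff r b ≡ + m → r ≡ b + m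
diff-pos r zero m refl = refl
diff-pos zero (suc b) m ()
diff-pos (suc r) (suc b) m eq = cong suc (diff-pos r b m eq)

diff-neg : ∀ r b m → diff r b ≡ -[1+ m ] → b ≡ r + suc m
diff-neg r zero m ()
diff-neg zero (suc b) m refl = refl
diff-neg (suc r) (suc b) m eq = cong suc (diff-neg r b m eq)

m≢n+suc-m : ∀ m y → m ≡ y + suc m → ⊥
m≢n+suc-m m y eq = <-irrefl refl (≤-trans (s≤s (m≤n+m m y)) (≤-reflexive (trans (sym (+-suc y m)) (sym eq))))

diff-injectiveʳ : ∀ m x y → diff m x ≡ diff m y → x ≡ y
diff-injectiveʳ m zero zero eq = refl
diff-injectiveʳ zero zero (suc y) ()
diff-injectiveʳ zero (suc x) zero ()
diff-injectiveʳ zero (suc x) (suc y) refl = refl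
diff-injectiveʳ (suc m) zero (suc y) eq = ⊥-elim (m≢n+suc-m m y (diff-pos m y (suc m) (sym eq)))
diff-injectiveʳ (suc m) (suc x) zero eq = ⊥-elim (m≢n+suc-m m x (diff-pos m x (suc m) eq))
diff-injectiveʳ (suc m) (suc x) (suc y) eq = cong suc (diff-injectiveʳ m x y eq)

areaSeq-head : ∀ r b p v rest → areaSeq r b p ≡ v ∷ rest → Σ ℕ (λ k → v ≡ diff (suc r) (b + k))
areaSeq-head r b [] v rest ()
areaSeq-head r b (N ∷ p) v rest eq = 0 , trans (sym (proj₁ (∷-injective eq))) (cong (diff (suc r)) (sym (+-identityʳ b)))
areaSeq-head r b (E ∷ p) v rest eq with areaSeq-head r (suc b) p v rest eq
... | k , e = suc k , trans e (cong (diff (suc r)) (sym (+-suc b k)))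

areaSeq-N≢E : ∀ r b p p' → areaSeq r b (N ∷ p) ≡ areaSeq r b (E ∷ p') → ⊥
areaSeq-N≢E r b p p' eq with areaSeq-head r (suc b) p' _ _ (sym eq)
... | k , e = m≢n+suc-m b k (trans (diff-injectiveʳ (suc r) b (suc (b + k)) e) (trans (cong suc (+-comm b k)) (sym (+-suc k b))))

areaSeq-injective : ∀ r b p p' → areaSeq r b p ≡ areaSeq r b p' → countE p ≡ countE p' → p ≡ p'
areaSeq-injective r b [] [] eq ce = refl
areaSeq-injective r b [] (N ∷ p') () ce
areaSeq-injective r b [] (E ∷ p') eq ()
areaSeq-injective r b (N ∷ p) [] () ce
areaSeq-injective r b (E ∷ p) [] eq ()
areaSeq-injective r b (N ∷ p) (N ∷ p') eq ce = cong (N ∷_) (areaSeq-injective (suc r) b p p' (proj₂ (∷-injective eq)) ce)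
areaSeq-injective r b (E ∷ p) (E ∷ p') eq ce = cong (E ∷_) (areaSeq-injective r (suc b) p p' eq (suc-injective ce))
areaSeq-injective r b (N ∷ p) (E ∷ p') eq ce = ⊥-elim (areaSeq-N≢E r b p p' eq)
areaSeq-injective r b (E ∷ p) (N ∷ p') eq ce = ⊥-elim (areaSeq-N≢E r b p' p (sym eq))

-- pathOf p a has area vector a when drawn after a row with area-vector entry p (areaSeq-pathOf);
-- the north step of an entry v is preceded by gap p v east steps.
gap : ℤ → ℤ → ℕ
gap (+ p) (+ v) = suc p ∸ v
gap (+ p) -[1+ v ] = suc p + suc v
gap -[1+ p ] (+ v) = 0
gap -[1+ p ] -[1+ v ] = suc v ∸ p

pathOf : ℤ → List ℤ → List Step
pathOf p (v ∷ a) = replicate (gap p v) E ++ N ∷ pathOf v a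
pathOf (+ m) [] = replicate m E
pathOf -[1+ _ ] [] = []

diff-cancelˡ : ∀ k m n → diff (k + m) (k + n) ≡ diff m n
diff-cancelˡ zero m n = refl
diff-cancelˡ (suc k) m n = diff-cancelˡ k m n

diff-gap : ∀ r b p v → diff r b ≡ p → Rise≤1 p v → diff (suc r) (b + gap p v) ≡ v
diff-gap r b (+ p) (+ v) eq le rewrite diff-pos r b p eq =
  trans (cong (λ z → diff z (b + (suc p ∸ v))) (sym (+-suc b p))) (trans (diff-cancelˡ b (suc p) (suc p ∸ v))
    (trans (cong (λ z → diff z (suc p ∸ v)) (sym (m∸n+n≡m le))) (trans (cong (λ z → diff ((suc p ∸ v) + v) z) (sym (+-identityʳ (suc p ∸ v)))) (diff-cancelˡ (suc p ∸ v) v 0))))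
diff-gap r b (+ p) -[1+ v ] eq le rewrite diff-pos r b p eq =
  trans (cong (λ z → diff z (b + (suc p + suc v))) (sym (+-suc b p))) (trans (diff-cancelˡ b (suc p) (suc p + suc v))
    (trans (cong (λ z → diff z (suc p + suc v)) (sym (+-identityʳ (suc p)))) (diff-cancelˡ (suc p) 0 (suc v))))
diff-gap r b -[1+ p ] (+ v) eq (refl , refl) rewrite diff-neg r b p eq =
  trans (cong (diff (suc r)) (trans (+-identityʳ (r + 1)) (+-comm r 1))) (trans (cong (λ z → diff z (suc r)) (sym (+-identityʳ (suc r)))) (trans (cong (diff (suc r + 0)) (sym (+-identityʳ (suc r)))) (diff-cancelˡ (suc r) 0 0)))
diff-gap r b -[1+ p ] -[1+ v ] eq le rewrite diff-neg r b p eq =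
  trans (cong (diff (suc r)) e) (trans (cong (λ z → diff z (suc r + suc v)) (sym (+-identityʳ (suc r)))) (diff-cancelˡ (suc r) 0 (suc v)))
  where
  e : r + suc p + (suc v ∸ p) ≡ suc r + suc v
  e = trans (cong (_+ (suc v ∸ p)) (+-suc r p)) (trans (cong suc (+-assoc r p (suc v ∸ p))) (cong (λ z → suc (r + z)) (m+[n∸m]≡n le)))

areaSeq-replicate-E-N : ∀ r b k rest → areaSeq r b (replicate k E ++ N ∷ rest) ≡ diff (suc r) (b + k) ∷ areaSeq (suc r) (b + k) rest
areaSeq-replicate-E-N r b zero rest rewrite +-identityʳ b = refl
areaSeq-replicate-E-N r b (suc k) rest rewrite +-suc b k = areaSeq-replicate-E-N r (suc b) k rest

areaSeq-replicate-E : ∀ r b k → areaSeq r b (replicate k E) ≡ []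
areaSeq-replicate-E r b zero = refl
areaSeq-replicate-E r b (suc k) = areaSeq-replicate-E r (suc b) k

areaSeq-pathOf : ∀ r b p a → diff r b ≡ p → Admissible p a → areaSeq r b (pathOf p a) ≡ a
areaSeq-pathOf r b (+ m) [] eq v = areaSeq-replicate-E r b m
areaSeq-pathOf r b -[1+ m ] [] eq ()
areaSeq-pathOf r b p (v ∷ a) eq (le , vz) = trans (areaSeq-replicate-E-N r b (gap p v) (pathOf v a))
  (cong₂ _∷_ (diff-gap r b p v eq le) (areaSeq-pathOf (suc r) (b + gap p v) v a (diff-gap r b p v eq le) vz))

countN-pathOf : ∀ p a → Admissible p a → countN (pathOf p a) ≡ length a
countN-pathOf (+ m) [] v = countN-replicate-E m
countN-pathOf -[1+ m ] [] ()
countN-pathOf p (x ∷ a) (_ , v) = trans (countN-++ (replicate (gap p x) E) (N ∷ pathOf x a)) (trans (cong (_+ suc (countN (pathOf x a))) (countN-replicate-E (gap p x))) (cong suc (countN-pathOf x a v)))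

countE-pathOf : ∀ r b p a → diff r b ≡ p → Admissible p a → b + countE (pathOf p a) ≡ r + length a
countE-pathOf r b (+ m) [] eq v = trans (cong (λ z → b + z) (countE-replicate-E m)) (trans (sym (diff-pos r b m eq)) (sym (+-identityʳ r)))
countE-pathOf r b -[1+ m ] [] eq ()
countE-pathOf r b p (x ∷ a) eq (le , v) = begin
    b + countE (replicate g E ++ N ∷ pathOf x a) ≡⟨ cong (λ z → b + z) (trans (countE-++ (replicate g E) (N ∷ pathOf x a)) (cong (_+ countE (pathOf x a)) (countE-replicate-E g))) ⟩
    b + (g + countE (pathOf x a)) ≡⟨ sym (+-assoc b g _) ⟩
    (b + g) + countE (pathOf x a) ≡⟨ countE-pathOf (suc r) (b + g) x a (diff-gap r b p x eq le) v ⟩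
    suc r + length a ≡⟨ sym (+-suc r (length a)) ⟩
    r + suc (length a) ∎
  where
  open ≡-Reasoning
  g = gap p x

∣diff∣≤ : ∀ m b n → m ≤ n → b ≤ n → ∣ diff m b ∣ ≤ n
∣diff∣≤ m zero n le _ = le
∣diff∣≤ zero (suc b) n _ le = le
∣diff∣≤ (suc m) (suc b) n le le' = ∣diff∣≤ m b n (≤-trans (n≤1+n m) le) (≤-trans (n≤1+n b) le')

areaSeq-bounded : ∀ n r b π → r + countN π ≤ n → b + countE π ≤ n → All (λ v → ∣ v ∣ ≤ n) (areaSeq r b π)
areaSeq-bounded n r b [] _ _ = []
areaSeq-bounded n r b (N ∷ p) l1 l2 =
  ∣diff∣≤ (suc r) b n (≤-trans (s≤s (m≤m+n r (countN p))) (≤-trans (≤-reflexive (sym (+-suc r (countN p)))) l1))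
    (≤-trans (m≤m+n b _) l2)
  ∷ areaSeq-bounded n (suc r) b p (subst (_≤ n) (+-suc r (countN p)) l1) l2
areaSeq-bounded n r b (E ∷ p) l1 l2 = areaSeq-bounded n r (suc b) p l1 (subst (_≤ n) (+-suc b (countE p)) l2)


-- Folding an area sequence

fold : List ℤ → List ℕ
fold [] = []
fold (+ zero ∷ a) = 0 ∷ (fold a ∷ʳ 0)
fold (+ suc m ∷ a) = suc m ∷ fold a
fold (-[1+ m ] ∷ a) = fold a ∷ʳ suc m

lastOr : ℕ → List ℕ → ℕ
lastOr p [] = p
lastOr p (x ∷ xs) = lastOr x xs

lastOr-∷ʳ : ∀ p xs y → lastOr p (xs ∷ʳ y) ≡ y
lastOr-∷ʳ p [] y = refl
lastOr-∷ʳ p (x ∷ xs) y = lastOr-∷ʳ x xs y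

Rising-∷ʳ : ∀ p xs y → Rising p xs → y ≤ suc (lastOr p xs) → Rising p (xs ∷ʳ y)
Rising-∷ʳ p [] y u le = le , tt
Rising-∷ʳ p (x ∷ xs) y (l , u) le = l , Rising-∷ʳ x xs y u le

Rising-∷ʳ⁻ : ∀ p xs y → Rising p (xs ∷ʳ y) → Rising p xs × (y ≤ suc (lastOr p xs))
Rising-∷ʳ⁻ p [] y (le , _) = tt , le
Rising-∷ʳ⁻ p (x ∷ xs) y (l , u) = (l , proj₁ (Rising-∷ʳ⁻ x xs y u)) , proj₂ (Rising-∷ʳ⁻ x xs y u)

mutual
  fold-Rising : ∀ l a → Admissible (+ l) a → Rising l (fold a)
  fold-Rising l [] v = tt
  fold-Rising l (+ zero ∷ a) (_ , v) = z≤n , Rising-∷ʳ 0 (fold a) 0 (fold-Rising 0 a v) z≤n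
  fold-Rising l (+ suc k ∷ a) (le , v) = le , fold-Rising (suc k) a v
  fold-Rising l (-[1+ m ] ∷ a) (_ , v) with fold-Rising-neg m a v
  ... | t , eq , u rewrite eq = z≤n , u

  fold-Rising-neg : ∀ m a → Admissible -[1+ m ] a → Σ (List ℕ) (λ t → (fold a ≡ 0 ∷ t) × Rising 0 (t ∷ʳ suc m))
  fold-Rising-neg m [] ()
  fold-Rising-neg m (+ zero ∷ a) ((_ , refl) , v) =
    (fold a ∷ʳ 0) , refl , Rising-∷ʳ 0 (fold a ∷ʳ 0) 1 (Rising-∷ʳ 0 (fold a) 0 (fold-Rising 0 a v) z≤n)
      (≤-reflexive (cong suc (sym (lastOr-∷ʳ 0 (fold a) 0))))
  fold-Rising-neg m (+ suc k ∷ a) ((() , _) , v)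
  fold-Rising-neg m (-[1+ m' ] ∷ a) (le , v) with fold-Rising-neg m' a v
  ... | t , eq , u rewrite eq =
    (t ∷ʳ suc m') , refl , Rising-∷ʳ 0 (t ∷ʳ suc m') (suc m) u (≤-trans (s≤s le) (≤-reflexive (cong suc (sym (lastOr-∷ʳ 0 t (suc m'))))))

zeros-∷ʳ : ∀ xs y → zeros (xs ∷ʳ y) ≡ zeros xs + zeros (y ∷ [])
zeros-∷ʳ xs y = zeros-++ xs (y ∷ [])

initOr : ℕ → List ℕ → List ℕ
initOr x [] = []
initOr x (y ∷ ys) = x ∷ initOr y ys

initOr-∷ʳ : ∀ x xs y → initOr x (xs ∷ʳ y) ≡ x ∷ xs
initOr-∷ʳ x [] y = refl
initOr-∷ʳ x (z ∷ xs) y = cong (x ∷_) (initOr-∷ʳ z xs y)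

initOr-lastOr : ∀ x t → x ∷ t ≡ initOr x t ∷ʳ lastOr x t
initOr-lastOr x [] = refl
initOr-lastOr x (y ∷ t) = cong (x ∷_) (initOr-lastOr y t)

-- Inverse of fold on sequences with an even number of zeros (fold-unfold); the first argument is fuel.
mutual
  unfold : ℕ → List ℕ → List ℤ
  unfold zero _ = []
  unfold (suc F) [] = []
  unfold (suc F) (suc m ∷ t) = + suc m ∷ unfold F t
  unfold (suc F) (zero ∷ []) = []
  unfold (suc F) (zero ∷ x ∷ t) = unfoldFrom F (lastOr x t) (initOr x t)

  unfoldFrom : ℕ → ℕ → List ℕ → List ℤ
  unfoldFrom F zero u = + 0 ∷ unfold F u
  unfoldFrom F (suc m) u = -[1+ m ] ∷ unfold F (zero ∷ u)

unfold-∷ʳ : ∀ F xs y → unfold (suc F) (zero ∷ (xs ∷ʳ y)) ≡ unfoldFrom F y xs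
unfold-∷ʳ F [] y = refl
unfold-∷ʳ F (x ∷ xs) y rewrite lastOr-∷ʳ x xs y | initOr-∷ʳ x xs y = refl

length-fold : ∀ a → length (fold a) + length (fold a) ≡ (length a + length a) + zeros (fold a)
length-fold [] = refl
length-fold (+ zero ∷ a) rewrite length-∷ʳ (fold a) 0 | zeros-∷ʳ (fold a) 0 = rearrange (length (fold a)) (length a) (zeros (fold a)) (length-fold a)
  where
  rearrange : ∀ L A Z → L + L ≡ A + A + Z → suc (suc L) + suc (suc L) ≡ suc A + suc A + suc (Z + 1)
  rearrange L A Z h = trans (rearrange₁ L) (trans (cong (_+ 4) h) (rearrange₂ A Z))
    where
    rearrange₁ : ∀ L → suc (suc L) + suc (suc L) ≡ (L + L) + 4
    rearrange₁ = solve-∀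
    rearrange₂ : ∀ A Z → A + A + Z + 4 ≡ suc A + suc A + suc (Z + 1)
    rearrange₂ = solve-∀
length-fold (+ suc m ∷ a) = rearrange (length (fold a)) (length a) (zeros (fold a)) (length-fold a)
  where
  rearrange : ∀ L A Z → L + L ≡ A + A + Z → suc L + suc L ≡ suc A + suc A + Z
  rearrange L A Z h = trans (rearrange₁ L) (trans (cong (_+ 2) h) (rearrange₂ A Z))
    where
    rearrange₁ : ∀ L → suc L + suc L ≡ (L + L) + 2
    rearrange₁ = solve-∀
    rearrange₂ : ∀ A Z → A + A + Z + 2 ≡ suc A + suc A + Z
    rearrange₂ = solve-∀
length-fold (-[1+ m ] ∷ a) rewrite length-∷ʳ (fold a) (suc m) | zeros-∷ʳ (fold a) (suc m) = rearrange (length (fold a)) (length a) (zeros (fold a)) (length-fold a)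
  where
  rearrange : ∀ L A Z → L + L ≡ A + A + Z → suc L + suc L ≡ suc A + suc A + (Z + 0)
  rearrange L A Z h = trans (rearrange₁ L) (trans (cong (_+ 2) h) (rearrange₂ A Z))
    where
    rearrange₁ : ∀ L → suc L + suc L ≡ (L + L) + 2
    rearrange₁ = solve-∀
    rearrange₂ : ∀ A Z → A + A + Z + 2 ≡ suc A + suc A + (Z + 0)
    rearrange₂ = solve-∀

unfold-fold : ∀ F p a → length (fold a) ≤ F → Admissible p a → unfold F (fold a) ≡ a
unfold-fold F p [] le v = unfold-[] F
  where
  unfold-[] : ∀ F → unfold F [] ≡ []
  unfold-[] zero = refl
  unfold-[] (suc F) = refl
unfold-fold (suc F) p (+ zero ∷ a) (s≤s le) (_ , v) =
  trans (unfold-∷ʳ F (fold a) 0) (cong (+ 0 ∷_) (unfold-fold F (+ 0) a (≤-trans (n≤1+n _) (≤-trans (≤-reflexive (sym (length-∷ʳ (fold a) 0))) le)) v))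
unfold-fold (suc F) p (+ suc k ∷ a) (s≤s le) (_ , v) = cong (+ suc k ∷_) (unfold-fold F (+ suc k) a le v)
unfold-fold zero p (+ zero ∷ a) () v
unfold-fold zero p (+ suc k ∷ a) () v
unfold-fold zero p (-[1+ m ] ∷ a) le (_ , v) with () ← ≤-trans (≤-reflexive (sym (length-∷ʳ (fold a) (suc m)))) le
unfold-fold (suc F) p (-[1+ m ] ∷ a) le (_ , v) with fold-Rising-neg m a v | unfold-fold F -[1+ m ] a
... | t , eq , u | ih rewrite eq =
  trans (unfold-∷ʳ F t (suc m)) (cong (-[1+ m ] ∷_) (ih (≤-pred (≤-trans (≤-reflexive (sym (length-∷ʳ (0 ∷ t) (suc m)))) le)) v))

fold-unfold : ∀ F h → length h ≤ F → Even (zeros h) → fold (unfold F h) ≡ h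
fold-unfold zero [] le e = refl
fold-unfold (suc F) [] le e = refl
fold-unfold (suc F) (suc m ∷ t) (s≤s le) e = cong (suc m ∷_) (fold-unfold F t le e)
fold-unfold (suc F) (zero ∷ []) le ()
fold-unfold (suc F) (zero ∷ x ∷ t) (s≤s le) e = go (lastOr x t) (initOr x t) (initOr-lastOr x t)
  where
  go : ∀ y u → x ∷ t ≡ u ∷ʳ y → fold (unfoldFrom F y u) ≡ zero ∷ x ∷ t
  go zero u eq = trans (cong (λ z → 0 ∷ (z ∷ʳ 0)) (fold-unfold F u lu (ev u eq'))) (cong (0 ∷_) (sym eq))
    where
    lu : length u ≤ F
    lu = ≤-trans (n≤1+n _) (subst (_≤ F) (trans (cong length eq) (length-∷ʳ u 0)) le)
    eq' : zeros (zero ∷ x ∷ t) ≡ suc (suc (zeros u))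
    eq' = cong suc (trans (cong zeros eq) (trans (zeros-∷ʳ u 0) (+-comm (zeros u) 1)))
    ev : ∀ u → zeros (zero ∷ x ∷ t) ≡ suc (suc (zeros u)) → Even (zeros u)
    ev u q with subst Even q e
    ... | even2 r = r
  go (suc m) u eq = trans (cong (_∷ʳ suc m) (fold-unfold F (zero ∷ u) lu (subst Even eq' e))) (cong (0 ∷_) (sym eq))
    where
    lu : length (zero ∷ u) ≤ F
    lu = subst (_≤ F) (trans (cong length eq) (length-∷ʳ u (suc m))) le
    eq' : zeros (zero ∷ x ∷ t) ≡ zeros (zero ∷ u)
    eq' = cong suc (trans (cong zeros eq) (trans (zeros-∷ʳ u (suc m)) (+-identityʳ (zeros u))))

length-unfold : ∀ F h → length h ≤ F → Even (zeros h) → (length (unfold F h) + length (unfold F h)) + zeros h ≡ length h + length h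
length-unfold F h le e = trans (cong (λ z → (length (unfold F h) + length (unfold F h)) + zeros z) (sym fu))
  (trans (sym (length-fold (unfold F h))) (cong (λ z → length z + length z) fu))
  where fu = fold-unfold F h le e

mutual
  unfold-Admissible : ∀ F l h → length h ≤ F → Even (zeros h) → Rising l h → Admissible (+ l) (unfold F h)
  unfold-Admissible zero l [] le e u = tt
  unfold-Admissible (suc F) l [] le e u = tt
  unfold-Admissible (suc F) l (suc k ∷ t) (s≤s le) e (lk , u) = lk , unfold-Admissible F (suc k) t le e u
  unfold-Admissible (suc F) l (zero ∷ []) le () u
  unfold-Admissible (suc F) l (zero ∷ x ∷ t) (s≤s le) e (_ , u) = go (lastOr x t) (initOr x t) (initOr-lastOr x t)
    where
    go : ∀ y v → x ∷ t ≡ v ∷ʳ y → Admissible (+ l) (unfoldFrom F y v)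
    go zero v eq = z≤n , unfold-Admissible F 0 v lv (ev' (subst Even eq' e)) (proj₁ (Rising-∷ʳ⁻ 0 v 0 (subst (Rising 0) eq u)))
      where
      lv : length v ≤ F
      lv = ≤-trans (n≤1+n _) (subst (_≤ F) (trans (cong length eq) (length-∷ʳ v 0)) le)
      eq' : zeros (zero ∷ x ∷ t) ≡ suc (suc (zeros v))
      eq' = cong suc (trans (cong zeros eq) (trans (zeros-∷ʳ v 0) (+-comm (zeros v) 1)))
      ev' : Even (suc (suc (zeros v))) → Even (zeros v)
      ev' (even2 r) = r
    go (suc m) v eq = tt , unfold-Admissible-neg F m v lv (subst Even eq' e) (proj₁ us) (proj₂ us)
      where
      us = Rising-∷ʳ⁻ 0 v (suc m) (subst (Rising 0) eq u)
      lv : length (zero ∷ v) ≤ F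
      lv = subst (_≤ F) (trans (cong length eq) (length-∷ʳ v (suc m))) le
      eq' : zeros (zero ∷ x ∷ t) ≡ zeros (zero ∷ v)
      eq' = cong suc (trans (cong zeros eq) (trans (zeros-∷ʳ v (suc m)) (+-identityʳ (zeros v))))

  unfold-Admissible-neg : ∀ F m u → length (zero ∷ u) ≤ F → Even (zeros (zero ∷ u)) → Rising 0 u → suc m ≤ suc (lastOr 0 u) → Admissible -[1+ m ] (unfold F (zero ∷ u))
  unfold-Admissible-neg (suc F) m [] le () u lm
  unfold-Admissible-neg (suc F) m (x ∷ t) (s≤s le) e u lm = go (lastOr x t) (initOr x t) (initOr-lastOr x t)
    where
    go : ∀ y v → x ∷ t ≡ v ∷ʳ y → Admissible -[1+ m ] (unfoldFrom F y v)
    go zero v eq = (refl , m0) , unfold-Admissible F 0 v lv (ev' (subst Even eq' e)) (proj₁ (Rising-∷ʳ⁻ 0 v 0 (subst (Rising 0) eq u)))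
      where
      m0 : m ≡ 0
      m0 = n≤0⇒n≡0 (≤-pred (≤-trans lm (≤-reflexive (cong suc (trans (cong (lastOr 0) eq) (lastOr-∷ʳ 0 v 0))))))
      lv : length v ≤ F
      lv = ≤-trans (n≤1+n _) (subst (_≤ F) (trans (cong length eq) (length-∷ʳ v 0)) le)
      eq' : zeros (zero ∷ x ∷ t) ≡ suc (suc (zeros v))
      eq' = cong suc (trans (cong zeros eq) (trans (zeros-∷ʳ v 0) (+-comm (zeros v) 1)))
      ev' : Even (suc (suc (zeros v))) → Even (zeros v)
      ev' (even2 r) = r
    go (suc m') v eq = ≤-pred (≤-trans lm (≤-reflexive (cong suc (trans (cong (lastOr 0) eq) (lastOr-∷ʳ 0 v (suc m')))))) ,
                      unfold-Admissible-neg F m' v lv (subst Even eq' e) (proj₁ us) (proj₂ us)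
      where
      us = Rising-∷ʳ⁻ 0 v (suc m') (subst (Rising 0) eq u)
      lv : length (zero ∷ v) ≤ F
      lv = subst (_≤ F) (trans (cong length eq) (length-∷ʳ v (suc m'))) le
      eq' : zeros (zero ∷ x ∷ t) ≡ zeros (zero ∷ v)
      eq' = cong suc (trans (cong zeros eq) (trans (zeros-∷ʳ v (suc m')) (+-identityʳ (zeros v))))

fold-bounded : ∀ n a → All (λ v → ∣ v ∣ ≤ n) a → All (_< suc n) (fold a)
fold-bounded n [] [] = []
fold-bounded n (+ zero ∷ a) (_ ∷ b) = s≤s z≤n ∷ AllP.∷ʳ⁺ (fold-bounded n a b) (s≤s z≤n)
fold-bounded n (+ suc m ∷ a) (le ∷ b) = s≤s le ∷ fold-bounded n a b
fold-bounded n (-[1+ m ] ∷ a) (le ∷ b) = AllP.∷ʳ⁺ (fold-bounded n a b) (s≤s le)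


-- ζ_C as a sweep of the folded area sequence

stepAt-spec : ∀ i x → stepAt i x ≡ (if x ℕ.≡ᵇ suc i then E ∷ [] else if x ℕ.≡ᵇ i then N ∷ [] else [])
stepAt-spec zero zero = refl
stepAt-spec zero (suc zero) = refl
stepAt-spec zero (suc (suc x)) = refl
stepAt-spec (suc i) zero = refl
stepAt-spec (suc i) (suc x) = stepAt-spec i x

eqB-neg : ∀ m k → eqB -[1+ m ] -[1+ k ] ≡ (m ℕ.≡ᵇ k)
eqB-neg m k = isYes≡does (-[1+ m ] ℤ.≟ -[1+ k ])

eqB-pos : ∀ m k → eqB (+ m) (+ k) ≡ (m ℕ.≡ᵇ k)
eqB-pos m k = isYes≡does (+ m ℤ.≟ + k)

leftStepAt : ℕ → ℤ → List Step
leftStepAt i (+ zero) = stepAt i 0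
leftStepAt i (+ suc _) = []
leftStepAt i -[1+ m ] = stepAt i (suc m)

rightStepAt : ℕ → ℤ → List Step
rightStepAt i (+ m) = stepAt i m
rightStepAt i -[1+ _ ] = []

-i-1≡-[1+i] : ∀ i → (ℤ.- (+ i)) ℤ.- ℤ.1ℤ ≡ -[1+ i ]
-i-1≡-[1+i] zero = refl
-i-1≡-[1+i] (suc j) = cong (λ z → -[1+ suc z ]) (+-identityʳ j)

leftStep≡leftStepAt : ∀ i x → leftStep (+ i) x ≡ leftStepAt i x
leftStep≡leftStepAt i x rewrite -i-1≡-[1+i] i = go i x
  where
  go : ∀ i x → (if eqB x -[1+ i ] then E ∷ [] else if eqB x (ℤ.- (+ i)) then N ∷ [] else []) ≡ leftStepAt i x
  go zero (+ zero) = refl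
  go zero (+ suc m) = refl
  go (suc i) (+ zero) = refl
  go (suc i) (+ suc m) = refl
  go zero -[1+ m ] rewrite eqB-neg m zero = sym (stepAt-spec zero (suc m))
  go (suc i) -[1+ m ] rewrite eqB-neg m (suc i) | eqB-neg m i = sym (stepAt-spec (suc i) (suc m))

rightStep≡rightStepAt : ∀ i x → rightStep (+ i) x ≡ rightStepAt i x
rightStep≡rightStepAt i x rewrite +-comm i 1 = go i x
  where
  go : ∀ i x → (if eqB x (+ suc i) then E ∷ [] else if eqB x (+ i) then N ∷ [] else []) ≡ rightStepAt i x
  go i (+ m) rewrite eqB-pos m (suc i) | eqB-pos m i = sym (stepAt-spec i m)
  go i -[1+ m ] = refl

reverse-stepAt : ∀ i x → reverse (stepAt i x) ≡ stepAt i x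
reverse-stepAt zero zero = refl
reverse-stepAt zero (suc zero) = refl
reverse-stepAt zero (suc (suc x)) = refl
reverse-stepAt (suc i) zero = refl
reverse-stepAt (suc i) (suc x) = reverse-stepAt i x


reverse-rightStepAt : ∀ i x → reverse (rightStepAt i x) ≡ rightStepAt i x
reverse-rightStepAt i (+ m) = reverse-stepAt i m
reverse-rightStepAt i -[1+ _ ] = refl

concatMap-reverse : ∀ {A B : Set} (f : A → List B) → (∀ x → reverse (f x) ≡ f x) →
  ∀ xs → concatMap f (reverse xs) ≡ reverse (concatMap f xs)
concatMap-reverse f palindromic [] = refl
concatMap-reverse f palindromic (x ∷ xs) = begin
  concatMap f (reverse (x ∷ xs))               ≡⟨ cong (concatMap f) (unfold-reverse x xs) ⟩
  concatMap f (reverse xs ∷ʳ x)                ≡⟨ concatMap-++ f (reverse xs) [ x ] ⟩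
  concatMap f (reverse xs) ++ (f x ++ [])      ≡⟨ cong₂ _++_ (concatMap-reverse f palindromic xs) (trans (++-identityʳ (f x)) (sym (palindromic x))) ⟩
  reverse (concatMap f xs) ++ reverse (f x)    ≡⟨ reverse-++ (f x) (concatMap f xs) ⟨
  reverse (f x ++ concatMap f xs)              ∎
  where open ≡-Reasoning

round-fold : ∀ i a → round i (fold a) ≡ concatMap (rightStepAt i) a ++ reverse (concatMap (leftStepAt i) a)
round-fold i [] = refl
round-fold i (+ zero ∷ a) = begin
  s ++ round i (fold a ∷ʳ 0)          ≡⟨ cong (s ++_) (round-++ i (fold a) [ 0 ]) ⟩
  s ++ (round i (fold a) ++ (s ++ [])) ≡⟨ cong (λ w → s ++ (w ++ (s ++ []))) (round-fold i a) ⟩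
  s ++ ((R ++ reverse L) ++ (s ++ [])) ≡⟨ cong (s ++_) (++-assoc R (reverse L) (s ++ [])) ⟩
  s ++ (R ++ (reverse L ++ (s ++ []))) ≡⟨ cong (λ w → s ++ (R ++ (reverse L ++ w))) (trans (++-identityʳ s) (sym (reverse-stepAt i 0))) ⟩
  s ++ (R ++ (reverse L ++ reverse s)) ≡⟨ cong (λ w → s ++ (R ++ w)) (reverse-++ s L) ⟨
  s ++ (R ++ reverse (s ++ L))         ≡⟨ ++-assoc s R _ ⟨
  (s ++ R) ++ reverse (s ++ L)         ∎
  where
  open ≡-Reasoning
  s = stepAt i 0
  R = concatMap (rightStepAt i) a
  L = concatMap (leftStepAt i) a
round-fold i (+ suc m ∷ a) =
  trans (cong (stepAt i (suc m) ++_) (round-fold i a)) (sym (++-assoc (stepAt i (suc m)) _ _))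
round-fold i (-[1+ m ] ∷ a) = begin
  round i (fold a ∷ʳ suc m)            ≡⟨ round-++ i (fold a) [ suc m ] ⟩
  round i (fold a) ++ (s ++ [])        ≡⟨ cong₂ _++_ (round-fold i a) (trans (++-identityʳ s) (sym (reverse-stepAt i (suc m)))) ⟩
  (R ++ reverse L) ++ reverse s        ≡⟨ ++-assoc R (reverse L) (reverse s) ⟩
  R ++ (reverse L ++ reverse s)        ≡⟨ cong (R ++_) (reverse-++ s L) ⟨
  R ++ reverse (s ++ L)                ∎
  where
  open ≡-Reasoning
  s = stepAt i (suc m)
  R = concatMap (rightStepAt i) a
  L = concatMap (leftStepAt i) a

zetaRound≡ : ∀ a i → zetaRound a i ≡ reverse (round i (fold a))
zetaRound≡ a i = begin
  zetaRound a i
    ≡⟨ cong₂ _++_ (concatMap-cong (leftStep≡leftStepAt i) a) (concatMap-cong (rightStep≡rightStepAt i) (reverse a)) ⟩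
  L ++ concatMap (rightStepAt i) (reverse a) ≡⟨ cong (L ++_) (concatMap-reverse (rightStepAt i) (reverse-rightStepAt i) a) ⟩
  L ++ reverse R                             ≡⟨ cong (_++ reverse R) (reverse-involutive L) ⟨
  reverse (reverse L) ++ reverse R           ≡⟨ reverse-++ R (reverse L) ⟨
  reverse (R ++ reverse L)                   ≡⟨ cong reverse (round-fold i a) ⟨
  reverse (round i (fold a))                 ∎
  where
  open ≡-Reasoning
  R = concatMap (rightStepAt i) a
  L = concatMap (leftStepAt i) a

concat-zetaRounds : ∀ a m → concat (map (zetaRound a) (downFrom m)) ≡ reverse (sweep m (fold a))
concat-zetaRounds a zero = refl
concat-zetaRounds a (suc m) = begin
    zetaRound a m ++ concat (map (zetaRound a) (downFrom m)) ≡⟨ cong₂ _++_ (zetaRound≡ a m) (concat-zetaRounds a m) ⟩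
    reverse (round m (fold a)) ++ reverse (sweep m (fold a)) ≡⟨ sym (reverse-++ (sweep m (fold a)) _) ⟩
    reverse (sweep m (fold a) ++ round m (fold a)) ≡⟨ cong reverse (sym (sweep-suc m (fold a))) ⟩
    reverse (sweep (suc m) (fold a)) ∎
  where open ≡-Reasoning

zetaC≡sweep : ∀ n π → zetaC n π ≡ take (n + n) (reverse (sweep (suc n) (fold (areaSeq 0 0 π))))
zetaC≡sweep n π = trans (cong (λ a → take (n + n) (concat (map (zetaRound a) (downFrom (suc n))))) (areaVecFrom≡areaSeq 0 0 π))
  (cong (take (n + n)) (concat-zetaRounds (areaSeq 0 0 π) (suc n)))


-- The forest of a path

levelSeq : List Step → List ℕ
levelSeq π = fold (areaSeq 0 0 π)

levelForest : List Step → List Tree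
levelForest π = forestOf (suc (length (levelSeq π))) (0 ∷ levelSeq π)

module _ {n : ℕ} (π : List Step) (inL : InL n π) where

  areaSeq-Admissible₀ : Admissible (+ 0) (areaSeq 0 0 π)
  areaSeq-Admissible₀ = areaSeq-Admissible 0 0 π (≤-reflexive (trans (proj₂ inL) (sym (proj₁ inL))))

  levelSeq-bounded : All (_< suc n) (levelSeq π)
  levelSeq-bounded = fold-bounded n (areaSeq 0 0 π) (areaSeq-bounded n 0 0 π (≤-reflexive (proj₁ inL)) (≤-reflexive (proj₂ inL)))

  length-levelSeq : length (levelSeq π) + length (levelSeq π) ≡ (n + n) + zeros (levelSeq π)
  length-levelSeq = trans (length-fold (areaSeq 0 0 π)) (cong (λ m → (m + m) + zeros (levelSeq π)) (trans (length-areaSeq 0 0 π) (proj₁ inL)))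

  length-sweep-levelSeq : length (sweep (suc n) (levelSeq π)) ≡ n + n
  length-sweep-levelSeq = +-cancelʳ-≡ (zeros (levelSeq π)) _ _ (trans (length-sweep (suc n) (levelSeq π) levelSeq-bounded) length-levelSeq)

  zetaC≡reverse-sweep : zetaC n π ≡ reverse (sweep (suc n) (levelSeq π))
  zetaC≡reverse-sweep = trans (zetaC≡sweep n π) (take-all (n + n) _ (≤-reflexive (trans (length-reverse (sweep (suc n) (levelSeq π))) length-sweep-levelSeq)))

  depths-levelForest : depths (levelForest π) ≡ 0 ∷ levelSeq π
  depths-levelForest = depths-forestOf (suc (length (levelSeq π))) (0 ∷ levelSeq π) ≤-refl (fold-Rising 0 (areaSeq 0 0 π) areaSeq-Admissible₀)

  Height≤-levelForest : Height≤ (suc n) (levelForest π)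
  Height≤-levelForest = All<⇒Height≤ (suc n) (levelForest π) (subst (All (_< suc n)) (sym depths-levelForest) (s≤s z≤n ∷ levelSeq-bounded))

  bfsCode-levelForest : bfsCode (suc n) (levelForest π) ≡ N ∷ reverse (zetaC n π)
  bfsCode-levelForest = begin
    bfsCode (suc n) (levelForest π)                     ≡⟨ sweep-depths (suc n) (levelForest π) ⟨
    sweep (suc n) (depths (levelForest π))              ≡⟨ cong (sweep (suc n)) depths-levelForest ⟩
    N ∷ sweep (suc n) (levelSeq π)                      ≡⟨ cong (N ∷_) (reverse-involutive (sweep (suc n) (levelSeq π))) ⟨
    N ∷ reverse (reverse (sweep (suc n) (levelSeq π)))  ≡⟨ cong (λ w → N ∷ reverse w) zetaC≡reverse-sweep ⟨
    N ∷ reverse (zetaC n π)                             ∎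
    where open ≡-Reasoning

-- ζ_C is a bijection

N∷reverse-ballot : ∀ q β → QueueRun q (N ∷ reverse β) 0 → All (λ p → countE p ≤ countN p) (inits β)
N∷reverse-ballot zero β ()
N∷reverse-ballot (suc q) β run = Ballot⇒inits 0 β q (QueueRun-reverse⇒Ballot q β 0 run)

zetaC-ballot : ∀ n π → InL n π → InB n (zetaC n π)
zetaC-ballot n π inL =
  trans (cong length (zetaC≡reverse-sweep π inL)) (trans (length-reverse (sweep (suc n) (levelSeq π))) (length-sweep-levelSeq π inL)) ,
  N∷reverse-ballot (length (levelForest π)) (zetaC n π)
    (subst (λ w → QueueRun (length (levelForest π)) w 0) (bfsCode-levelForest π inL) (QueueRun-bfsCode (suc n) (levelForest π) (Height≤-levelForest π inL)))

-- The number of roots of a forest is the number of N's minus the number of E's of its code.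
bfsCode-injective : ∀ F ts ts′ → Height≤ F ts → Height≤ F ts′ → bfsCode F ts ≡ bfsCode F ts′ → ts ≡ ts′
bfsCode-injective F ts ts′ h h′ eq = begin
  ts                                       ≡⟨ bfsDecode-bfsCode F ts h ⟨
  bfsDecode F (length ts) (bfsCode F ts)   ≡⟨ cong₂ (bfsDecode F) same-length eq ⟩
  bfsDecode F (length ts′) (bfsCode F ts′) ≡⟨ bfsDecode-bfsCode F ts′ h′ ⟩
  ts′                                      ∎
  where
  open ≡-Reasoning
  same-length : length ts ≡ length ts′
  same-length = +-cancelʳ-≡ (countE (bfsCode F ts)) _ _ (begin
    length ts + countE (bfsCode F ts)    ≡⟨ bfsCode-count F ts h ⟩
    countN (bfsCode F ts)                ≡⟨ cong countN eq ⟩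
    countN (bfsCode F ts′)               ≡⟨ bfsCode-count F ts′ h′ ⟨
    length ts′ + countE (bfsCode F ts′)  ≡⟨ cong (λ w → length ts′ + countE w) eq ⟨
    length ts′ + countE (bfsCode F ts)   ∎)

fold-injective : ∀ a a′ → Admissible (+ 0) a → Admissible (+ 0) a′ → fold a ≡ fold a′ → a ≡ a′
fold-injective a a′ adm adm′ eq = begin
  a                                    ≡⟨ unfold-fold _ (+ 0) a ≤-refl adm ⟨
  unfold (length (fold a)) (fold a)    ≡⟨ cong (λ h → unfold (length h) h) eq ⟩
  unfold (length (fold a′)) (fold a′)  ≡⟨ unfold-fold _ (+ 0) a′ ≤-refl adm′ ⟩
  a′                                   ∎
  where open ≡-Reasoning

zetaC-injective : ∀ n π π′ → InL n π → InL n π′ → zetaC n π ≡ zetaC n π′ → π ≡ π′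
zetaC-injective n π π′ inL inL′ eq =
  areaSeq-injective 0 0 π π′ same-areaSeq (trans (proj₂ inL) (sym (proj₂ inL′)))
  where
  same-forest : levelForest π ≡ levelForest π′
  same-forest = bfsCode-injective (suc n) _ _ (Height≤-levelForest π inL) (Height≤-levelForest π′ inL′)
    (trans (bfsCode-levelForest π inL) (trans (cong (λ w → N ∷ reverse w) eq) (sym (bfsCode-levelForest π′ inL′))))
  same-levelSeq : levelSeq π ≡ levelSeq π′
  same-levelSeq = proj₂ (∷-injective
    (trans (sym (depths-levelForest π inL)) (trans (cong depths same-forest) (depths-levelForest π′ inL′))))
  same-areaSeq : areaSeq 0 0 π ≡ areaSeq 0 0 π′
  same-areaSeq = fold-injective _ _ (areaSeq-Admissible₀ π inL) (areaSeq-Admissible₀ π′ inL′) same-levelSeq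

ballot-countE≤ : ∀ n β → InB n β → countE β ≤ n
ballot-countE≤ n β (lenβ , prefixes) = m+m≤n+n⇒m≤n (countE β) n (begin
  countE β + countE β  ≤⟨ +-monoˡ-≤ (countE β) (m≤n+m (countE β) t) ⟩
  t + countE β + countE β ≡⟨ cong (_+ countE β) (Ballot-count 0 β t (proj₂ ballot)) ⟨
  countN β + countE β  ≡⟨ length≡countN+countE β ⟨
  length β             ≡⟨ lenβ ⟩
  n + n                ∎)
  where
  open ≤-Reasoning
  ballot = inits⇒Ballot 0 β prefixes
  t = proj₁ ballot

ballot-forest : ∀ n β → InB n β → ∃ λ ts → Height≤ (suc n) ts × bfsCode (suc n) ts ≡ N ∷ reverse β
ballot-forest n β inB@(_ , prefixes) =
  ts , height , trans (bfsCode-fuel (suc n) F ts height (BfsDecoding.height D)) (BfsDecoding.encodes D)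
  where
  ballot = inits⇒Ballot 0 β prefixes
  w = N ∷ reverse β
  F = countN w
  D = bfsDecode-sound F (suc (proj₁ ballot)) w ≤-refl (Ballot⇒QueueRun-reverse (proj₁ ballot) β 0 (proj₂ ballot)) tt
  ts = bfsDecode F (suc (proj₁ ballot)) w
  height : Height≤ (suc n) ts
  height = Height≤-countE n F ts (BfsDecoding.height D)
    (subst (_≤ n) (sym (trans (cong countE (BfsDecoding.encodes D)) (countE-reverse β))) (ballot-countE≤ n β inB))

depths-cons : ∀ F ts {w} → bfsCode F ts ≡ N ∷ w → ∃ λ h → depths ts ≡ 0 ∷ h
depths-cons F [] eq with () ← trans (sym (bfsCode-[] F)) eq
depths-cons F (node cs ∷ ts) _ = _ , refl

ballot-levels : ∀ n β → InB n β → ∃ λ h → Rising 0 h × All (_< suc n) h × sweep (suc n) h ≡ reverse β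
ballot-levels n β inB with ballot-forest n β inB
... | ts , height , code with depths-cons (suc n) ts code
...   | h , depths≡ =
  h ,
  subst DepthSeq depths≡ (DepthSeq-depths ts) ,
  All.tail (subst (All (_< suc n)) depths≡ (Height≤⇒All< (suc n) ts height)) ,
  proj₂ (∷-injective (trans (cong (sweep (suc n)) (sym depths≡)) (trans (sweep-depths (suc n) ts) code)))

unfold-levels : ∀ n h → Rising 0 h → All (_< suc n) h → length (sweep (suc n) h) ≡ n + n →
  ∃ λ a → Admissible (+ 0) a × fold a ≡ h × length a ≡ n
unfold-levels n h rising bounded len =
  unfold (length h) h ,
  unfold-Admissible (length h) 0 h ≤-refl even rising ,
  fold-unfold (length h) h ≤-refl even ,
  m+m≡n+n⇒m≡n _ n (+-cancelʳ-≡ (zeros h) _ _ (trans (length-unfold (length h) h ≤-refl even) (sym sizes)))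
  where
  sizes : (n + n) + zeros h ≡ length h + length h
  sizes = trans (cong (_+ zeros h) (sym len)) (length-sweep (suc n) h bounded)
  even : Even (zeros h)
  even = even-difference n (zeros h) (length h) sizes

pathOf-InL : ∀ n a → Admissible (+ 0) a → length a ≡ n → InL n (pathOf (+ 0) a)
pathOf-InL n a adm len = trans (countN-pathOf (+ 0) a adm) len , trans (countE-pathOf 0 0 (+ 0) a refl adm) len

zetaC-surjective : ∀ n β → InB n β → ∃ λ π → InL n π × zetaC n π ≡ β
zetaC-surjective n β inB@(lenβ , _) with ballot-levels n β inB
... | h , rising , bounded , sweep≡ with unfold-levels n h rising bounded (trans (cong length sweep≡) (trans (length-reverse β) lenβ))
...   | a , adm , fold≡ , len = pathOf (+ 0) a , pathOf-InL n a adm len , (begin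
  zetaC n (pathOf (+ 0) a)
    ≡⟨ zetaC≡sweep n (pathOf (+ 0) a) ⟩
  take (n + n) (reverse (sweep (suc n) (fold (areaSeq 0 0 (pathOf (+ 0) a)))))
    ≡⟨ cong (λ a′ → take (n + n) (reverse (sweep (suc n) (fold a′)))) (areaSeq-pathOf 0 0 (+ 0) a refl adm) ⟩
  take (n + n) (reverse (sweep (suc n) (fold a)))
    ≡⟨ cong (λ h′ → take (n + n) (reverse (sweep (suc n) h′))) fold≡ ⟩
  take (n + n) (reverse (sweep (suc n) h))
    ≡⟨ cong (λ w → take (n + n) (reverse w)) sweep≡ ⟩
  take (n + n) (reverse (reverse β))
    ≡⟨ cong (take (n + n)) (reverse-involutive β) ⟩
  take (n + n) β
    ≡⟨ take-all (n + n) β (≤-reflexive lenβ) ⟩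
  β ∎)
  where open ≡-Reasoning

-- Inversions of a path and near pairs of a level sequence

invNE : List Step → ℕ
invNE [] = 0
invNE (N ∷ w) = countE w + invNE w
invNE (E ∷ w) = invNE w

-- Pairs E … N in β, with e further E steps in front of β.
invEN : ℕ → List Step → ℕ
invEN e [] = 0
invEN e (N ∷ β) = e + invEN e β
invEN e (E ∷ β) = invEN (suc e) β

choose2 : ℕ → ℕ
choose2 zero = 0
choose2 (suc m) = m + choose2 m

choose2-+ : ∀ a b → choose2 (a + b) ≡ choose2 a + choose2 b + a * b
choose2-+ zero b = sym (+-identityʳ (choose2 b))
choose2-+ (suc a) b rewrite choose2-+ a b = rearrange a b (choose2 a) (choose2 b)
  where
  rearrange : ∀ a b sa sb → a + b + (sa + sb + a * b) ≡ a + sa + sb + (b + a * b)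
  rearrange = solve-∀

invNE-++ : ∀ xs ys → invNE (xs ++ ys) ≡ invNE xs + countN xs * countE ys + invNE ys
invNE-++ [] ys = refl
invNE-++ (N ∷ xs) ys rewrite invNE-++ xs ys | countE-++ xs ys = rearrange (countE xs) (countE ys) (invNE xs) (countN xs) (invNE ys)
  where
  rearrange : ∀ a b q c r → a + b + (q + c * b + r) ≡ a + q + suc c * b + r
  rearrange = solve-∀
invNE-++ (E ∷ xs) ys = invNE-++ xs ys

invEN-++ : ∀ e xs ys → invEN e (xs ++ ys) ≡ invEN e xs + invEN (e + countE xs) ys
invEN-++ e [] ys rewrite +-identityʳ e = refl
invEN-++ e (N ∷ xs) ys rewrite invEN-++ e xs ys = sym (+-assoc e (invEN e xs) _)
invEN-++ e (E ∷ xs) ys rewrite invEN-++ (suc e) xs ys | +-suc e (countE xs) = refl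

invEN-reverse : ∀ w → invEN 0 (reverse w) ≡ invNE w
invEN-reverse [] = refl
invEN-reverse (x ∷ w) rewrite unfold-reverse x w | invEN-++ 0 (reverse w) (x ∷ []) | invEN-reverse w = go x
  where
  go : ∀ x → invNE w + invEN (countE (reverse w)) (x ∷ []) ≡ invNE (x ∷ w)
  go N rewrite countE-reverse w = trans (cong (_+_ (invNE w)) (+-identityʳ (countE w))) (+-comm (invNE w) (countE w))
  go E = +-identityʳ (invNE w)

near : ℕ → ℕ → ℕ
near zero zero = 1
near zero (suc _) = 0
near (suc x) (suc y) = near x y
near (suc zero) zero = 1
near (suc (suc _)) zero = 0

dinvLevels : List ℕ → ℕ
dinvLevels [] = 0
dinvLevels (x ∷ h) = sumBy (near x) h + dinvLevels h

ones : List ℕ → ℕ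
ones h = zeros (lower h)

pairs10 : List ℕ → ℕ
pairs10 [] = 0
pairs10 (zero ∷ h) = pairs10 h
pairs10 (suc zero ∷ h) = zeros h + pairs10 h
pairs10 (suc (suc _) ∷ h) = pairs10 h

pairs01 : List ℕ → ℕ
pairs01 [] = 0
pairs01 (zero ∷ h) = ones h + pairs01 h
pairs01 (suc _ ∷ h) = pairs01 h

sumBy-near0 : ∀ h → sumBy (near 0) h ≡ zeros h
sumBy-near0 [] = refl
sumBy-near0 (zero ∷ h) = cong suc (sumBy-near0 h)
sumBy-near0 (suc _ ∷ h) = sumBy-near0 h

sumBy-near-suc : ∀ x h → sumBy (near (suc x)) h ≡ sumBy (near x) (lower h) + (if x ℕ.≡ᵇ 0 then zeros h else 0)
sumBy-near-suc x [] with x ℕ.≡ᵇ 0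
... | true = refl
... | false = refl
sumBy-near-suc zero (zero ∷ h) = trans (cong suc (sumBy-near-suc zero h)) (sym (+-suc (sumBy (near zero) (lower h)) (zeros h)))
sumBy-near-suc (suc x) (zero ∷ h) = sumBy-near-suc (suc x) h
sumBy-near-suc x (suc y ∷ h) = trans (cong (_+_ (near x y)) (sumBy-near-suc x h)) (sym (+-assoc (near x y) _ _))

dinvLevels-lower : ∀ h → dinvLevels h ≡ dinvLevels (lower h) + choose2 (zeros h) + pairs10 h
dinvLevels-lower [] = refl
dinvLevels-lower (zero ∷ h) rewrite sumBy-near0 h | dinvLevels-lower h = rearrange (zeros h) (dinvLevels (lower h)) (choose2 (zeros h)) (pairs10 h)
  where
  rearrange : ∀ z d s p → z + (d + s + p) ≡ d + (z + s) + p
  rearrange = solve-∀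
dinvLevels-lower (suc zero ∷ h) rewrite sumBy-near-suc zero h | dinvLevels-lower h | sumBy-near0 (lower h) =
  rearrange (zeros (lower h)) (zeros h) (dinvLevels (lower h)) (choose2 (zeros h)) (pairs10 h)
  where
  rearrange : ∀ o z d s p → o + z + (d + s + p) ≡ o + d + s + (z + p)
  rearrange = solve-∀
dinvLevels-lower (suc (suc x) ∷ h) rewrite sumBy-near-suc (suc x) h | dinvLevels-lower h =
  rearrange (sumBy (near (suc x)) (lower h)) (dinvLevels (lower h)) (choose2 (zeros h)) (pairs10 h)
  where
  rearrange : ∀ c d s p → c + 0 + (d + s + p) ≡ c + d + s + p
  rearrange = solve-∀

countN-round0 : ∀ h → countN (round 0 h) ≡ zeros h
countN-round0 [] = refl
countN-round0 (zero ∷ h) = cong suc (countN-round0 h)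
countN-round0 (suc zero ∷ h) = countN-round0 h
countN-round0 (suc (suc _) ∷ h) = countN-round0 h

countE-round0 : ∀ h → countE (round 0 h) ≡ ones h
countE-round0 [] = refl
countE-round0 (zero ∷ h) = countE-round0 h
countE-round0 (suc zero ∷ h) = cong suc (countE-round0 h)
countE-round0 (suc (suc _) ∷ h) = countE-round0 h

invNE-round0 : ∀ h → invNE (round 0 h) ≡ pairs01 h
invNE-round0 [] = refl
invNE-round0 (zero ∷ h) = cong₂ _+_ (countE-round0 h) (invNE-round0 h)
invNE-round0 (suc zero ∷ h) = invNE-round0 h
invNE-round0 (suc (suc _) ∷ h) = invNE-round0 h

pairs10+pairs01 : ∀ h → pairs10 h + pairs01 h ≡ zeros h * ones h
pairs10+pairs01 [] = refl
pairs10+pairs01 (zero ∷ h) rewrite sym (pairs10+pairs01 h) = rearrange (pairs10 h) (ones h) (pairs01 h)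
  where
  rearrange : ∀ p o q → p + (o + q) ≡ o + (p + q)
  rearrange = solve-∀
pairs10+pairs01 (suc zero ∷ h) rewrite *-suc (zeros h) (ones h) | sym (pairs10+pairs01 h) = +-assoc (zeros h) (pairs10 h) (pairs01 h)
pairs10+pairs01 (suc (suc _) ∷ h) = pairs10+pairs01 h

sweep-count : ∀ F h → All (_< F) h → (countN (sweep F h) ≡ length h) × (countE (sweep F h) + zeros h ≡ length h)
sweep-count zero [] _ = refl , refl
sweep-count zero (x ∷ h) (() ∷ _)
sweep-count (suc F) h a = cn , ce
  where
  ih = sweep-count F (lower h) (lower-All< F h a)
  cn : countN (round 0 h ++ sweep F (lower h)) ≡ length h
  cn = trans (countN-++ (round 0 h) _) (trans (cong₂ _+_ (countN-round0 h) (proj₁ ih)) (trans (+-comm (zeros h) _) (length-lower h)))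
  ce : countE (round 0 h ++ sweep F (lower h)) + zeros h ≡ length h
  ce = trans (cong (_+ zeros h) (trans (countE-++ (round 0 h) _) (trans (cong (_+ countE (sweep F (lower h))) (countE-round0 h)) (+-comm (ones h) _))))
         (trans (cong (_+ zeros h) (proj₂ ih)) (length-lower h))

dinvLevels+invNE-sweep : ∀ F h → All (_< F) h → dinvLevels h + invNE (sweep F h) ≡ choose2 (length h)
dinvLevels+invNE-sweep zero [] _ = refl
dinvLevels+invNE-sweep zero (x ∷ h) (() ∷ _)
dinvLevels+invNE-sweep (suc F) h a = begin
    dinvLevels h + invNE (round 0 h ++ sweep F (lower h))
      ≡⟨ cong₂ _+_ (dinvLevels-lower h) (trans (invNE-++ (round 0 h) (sweep F (lower h))) (cong₂ (λ u v → u + v * countE (sweep F (lower h)) + invNE (sweep F (lower h))) (invNE-round0 h) (countN-round0 h))) ⟩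
    (dinvLevels (lower h) + choose2 (zeros h) + pairs10 h) + (pairs01 h + zeros h * countE (sweep F (lower h)) + invNE (sweep F (lower h)))
      ≡⟨ rearrange (dinvLevels (lower h)) (choose2 (zeros h)) (pairs10 h) (pairs01 h) (zeros h) (countE (sweep F (lower h))) (invNE (sweep F (lower h))) ⟩
    (dinvLevels (lower h) + invNE (sweep F (lower h))) + choose2 (zeros h) + (pairs10 h + pairs01 h) + zeros h * countE (sweep F (lower h))
      ≡⟨ cong₂ (λ u v → u + choose2 (zeros h) + v + zeros h * countE (sweep F (lower h))) (dinvLevels+invNE-sweep F (lower h) (lower-All< F h a)) (pairs10+pairs01 h) ⟩
    choose2 (length (lower h)) + choose2 (zeros h) + zeros h * ones h + zeros h * countE (sweep F (lower h))
      ≡⟨ rearrange₂ (choose2 (length (lower h))) (choose2 (zeros h)) (zeros h) (ones h) (countE (sweep F (lower h))) ⟩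
    choose2 (length (lower h)) + choose2 (zeros h) + zeros h * (countE (sweep F (lower h)) + ones h)
      ≡⟨ cong (λ u → choose2 (length (lower h)) + choose2 (zeros h) + zeros h * u) (proj₂ (sweep-count F (lower h) (lower-All< F h a))) ⟩
    choose2 (length (lower h)) + choose2 (zeros h) + zeros h * length (lower h)
      ≡⟨ cong (_+_ (choose2 (length (lower h)) + choose2 (zeros h))) (*-comm (zeros h) (length (lower h))) ⟩
    choose2 (length (lower h)) + choose2 (zeros h) + length (lower h) * zeros h
      ≡⟨ sym (choose2-+ (length (lower h)) (zeros h)) ⟩
    choose2 (length (lower h) + zeros h)
      ≡⟨ cong choose2 (length-lower h) ⟩
    choose2 (length h) ∎
  where
  open ≡-Reasoning
  rearrange : ∀ d s p q z e w → (d + s + p) + (q + z * e + w) ≡ (d + w) + s + (p + q) + z * e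
  rearrange = solve-∀
  rearrange₂ : ∀ a s z o e → a + s + z * o + z * e ≡ a + s + z * (e + o)
  rearrange₂ = solve-∀


-- dinv of an area sequence through its fold

length-filterᵇ : ∀ (p : ℤ → Bool) xs → length (filterᵇ p xs) ≡ sumBy (λ y → fromBool (p y)) xs
length-filterᵇ p [] = refl
length-filterᵇ p (x ∷ xs) with p x
... | true = cong suc (length-filterᵇ p xs)
... | false = length-filterᵇ p xs

dinvWeight : ℤ → ℤ → ℕ
dinvWeight x y = fromBool (eqB x y) + fromBool (eqB x (y ℤ.+ ℤ.1ℤ)) + fromBool (eqB x (ℤ.- y)) + fromBool (eqB x ((ℤ.- y) ℤ.+ ℤ.1ℤ))

zerosℤ : List ℤ → ℕ
zerosℤ a = length (filterᵇ (λ x → eqB x (+ 0)) a)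

length-filterᵇ-∷ : ∀ (p : ℤ → Bool) x xs → length (filterᵇ p (x ∷ xs)) ≡ fromBool (p x) + length (filterᵇ p xs)
length-filterᵇ-∷ p x xs with p x
... | true = refl
... | false = refl

dinvVec-∷ : ∀ x a → dinvVec (x ∷ a) ≡ dinvVec a + (sumBy (dinvWeight x) a + fromBool (eqB x (+ 0)))
dinvVec-∷ x a = begin
    (l1 + c1) + (l2 + c2) + (l3 + c3) + (l4 + c4) + length (filterᵇ q (x ∷ a))
      ≡⟨ cong (λ u → (l1 + c1) + (l2 + c2) + (l3 + c3) + (l4 + c4) + u) (length-filterᵇ-∷ q x a) ⟩
    (l1 + c1) + (l2 + c2) + (l3 + c3) + (l4 + c4) + (fromBool (q x) + length (filterᵇ q a))
      ≡⟨ rearrange l1 l2 l3 l4 c1 c2 c3 c4 (fromBool (q x)) (length (filterᵇ q a)) ⟩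
    (c1 + c2 + c3 + c4 + length (filterᵇ q a)) + ((l1 + l2 + l3 + l4) + fromBool (q x))
      ≡⟨ cong (λ u → (c1 + c2 + c3 + c4 + length (filterᵇ q a)) + (u + fromBool (q x))) lsum ⟩
    (c1 + c2 + c3 + c4 + length (filterᵇ q a)) + (sumBy (dinvWeight x) a + fromBool (q x)) ∎
  where
  open ≡-Reasoning
  q : ℤ → Bool
  q = λ x → eqB x (+ 0)
  f1 f2 f3 f4 : ℤ → Bool
  f1 = λ y → eqB x y
  f2 = λ y → eqB x (y ℤ.+ ℤ.1ℤ)
  f3 = λ y → eqB x (ℤ.- y)
  f4 = λ y → eqB x ((ℤ.- y) ℤ.+ ℤ.1ℤ)
  l1 = length (filterᵇ f1 a)
  l2 = length (filterᵇ f2 a)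
  l3 = length (filterᵇ f3 a)
  l4 = length (filterᵇ f4 a)
  c1 = countPairs (λ x y → eqB x y) a
  c2 = countPairs (λ x y → eqB x (y ℤ.+ ℤ.1ℤ)) a
  c3 = countPairs (λ x y → eqB x (ℤ.- y)) a
  c4 = countPairs (λ x y → eqB x ((ℤ.- y) ℤ.+ ℤ.1ℤ)) a
  rearrange : ∀ l1 l2 l3 l4 c1 c2 c3 c4 z0 zr → (l1 + c1) + (l2 + c2) + (l3 + c3) + (l4 + c4) + (z0 + zr) ≡ (c1 + c2 + c3 + c4 + zr) + ((l1 + l2 + l3 + l4) + z0)
  rearrange = solve-∀
  lsum : l1 + l2 + l3 + l4 ≡ sumBy (dinvWeight x) a
  lsum = begin
    l1 + l2 + l3 + l4 ≡⟨ cong₂ (λ u v → u + v) (cong₂ (λ u v → u + v) (cong₂ (λ u v → u + v) (length-filterᵇ f1 a) (length-filterᵇ f2 a)) (length-filterᵇ f3 a)) (length-filterᵇ f4 a) ⟩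
    sumBy (λ y → fromBool (f1 y)) a + sumBy (λ y → fromBool (f2 y)) a + sumBy (λ y → fromBool (f3 y)) a + sumBy (λ y → fromBool (f4 y)) a
      ≡⟨ cong (λ u → u + sumBy (λ y → fromBool (f3 y)) a + sumBy (λ y → fromBool (f4 y)) a) (sym (sumBy-+ (λ y → fromBool (f1 y)) (λ y → fromBool (f2 y)) a)) ⟩
    sumBy (λ y → fromBool (f1 y) + fromBool (f2 y)) a + sumBy (λ y → fromBool (f3 y)) a + sumBy (λ y → fromBool (f4 y)) a
      ≡⟨ cong (λ u → u + sumBy (λ y → fromBool (f4 y)) a) (sym (sumBy-+ (λ y → fromBool (f1 y) + fromBool (f2 y)) (λ y → fromBool (f3 y)) a)) ⟩
    sumBy (λ y → fromBool (f1 y) + fromBool (f2 y) + fromBool (f3 y)) a + sumBy (λ y → fromBool (f4 y)) a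
      ≡⟨ sym (sumBy-+ (λ y → fromBool (f1 y) + fromBool (f2 y) + fromBool (f3 y)) (λ y → fromBool (f4 y)) a) ⟩
    sumBy (dinvWeight x) a ∎

image : ℤ → List ℕ
image (+ zero) = 0 ∷ 0 ∷ []
image (+ suc m) = suc m ∷ []
image -[1+ m ] = suc m ∷ []

sumBy-fold : ∀ f a → sumBy f (fold a) ≡ sumBy (λ y → sumBy f (image y)) a
sumBy-fold f [] = refl
sumBy-fold f (+ zero ∷ a) rewrite sumBy-++ f (fold a) (0 ∷ []) | sumBy-fold f a = rearrange (f 0) (sumBy (λ y → sumBy f (image y)) a)
  where
  rearrange : ∀ u s → u + (s + (u + 0)) ≡ u + (u + 0) + s
  rearrange = solve-∀
sumBy-fold f (+ suc m ∷ a) = trans (cong (λ u → f (suc m) + u) (sumBy-fold f a)) (cong (_+ sumBy (λ y → sumBy f (image y)) a) (sym (+-identityʳ (f (suc m)))))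
sumBy-fold f (-[1+ m ] ∷ a) rewrite sumBy-++ f (fold a) (suc m ∷ []) | sumBy-fold f a = +-comm (sumBy (λ y → sumBy f (image y)) a) (f (suc m) + 0)

dinvLevels-∷ʳ : ∀ h y → dinvLevels (h ∷ʳ y) ≡ dinvLevels h + sumBy (λ u → near u y) h
dinvLevels-∷ʳ [] y = refl
dinvLevels-∷ʳ (x ∷ h) y rewrite dinvLevels-∷ʳ h y | sumBy-++ (near x) h (y ∷ []) =
  rearrange (sumBy (near x) h) (near x y) (dinvLevels h) (sumBy (λ u → near u y) h)
  where
  rearrange : ∀ a r d s → a + (r + 0) + (d + s) ≡ a + d + (r + s)
  rearrange = solve-∀

twiceChoose2 : ℕ → ℕ
twiceChoose2 zero = 0
twiceChoose2 (suc z) = twiceChoose2 z + (z + z)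

+k+1≡+[1+k] : ∀ k → (+ k) ℤ.+ ℤ.1ℤ ≡ + suc k
+k+1≡+[1+k] k = cong +_ (+-comm k 1)

-ℕ : ℕ → ℤ
-ℕ zero = + 0
-ℕ (suc k) = -[1+ k ]

-[1+k]+1≡-k : ∀ k → -[1+ k ] ℤ.+ ℤ.1ℤ ≡ -ℕ k
-[1+k]+1≡-k zero = refl
-[1+k]+1≡-k (suc k) = refl

near-spec : ∀ x y → near x y ≡ fromBool (x ℕ.≡ᵇ y) + fromBool (x ℕ.≡ᵇ suc y)
near-spec zero zero = refl
near-spec zero (suc y) = refl
near-spec (suc x) (suc y) = near-spec x y
near-spec (suc zero) zero = refl
near-spec (suc (suc x)) zero = refl

dinvWeight-pos : ∀ x k → dinvWeight x (+ suc k) ≡ fromBool (eqB x (+ suc k)) + fromBool (eqB x (+ suc (suc k))) + fromBool (eqB x -[1+ k ]) + fromBool (eqB x (-ℕ k))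
dinvWeight-pos x k = cong₂ (λ u v → fromBool (eqB x (+ suc k)) + fromBool (eqB x u) + fromBool (eqB x -[1+ k ]) + fromBool (eqB x v)) (+k+1≡+[1+k] (suc k)) (-[1+k]+1≡-k k)

dinvWeight-neg : ∀ x k → dinvWeight x -[1+ k ] ≡ fromBool (eqB x -[1+ k ]) + fromBool (eqB x (-ℕ k)) + fromBool (eqB x (+ suc k)) + fromBool (eqB x (+ suc (suc k)))
dinvWeight-neg x k = cong₂ (λ u v → fromBool (eqB x -[1+ k ]) + fromBool (eqB x u) + fromBool (eqB x (+ suc k)) + fromBool (eqB x v)) (-[1+k]+1≡-k k) (+k+1≡+[1+k] (suc k))

near-image-pos : ∀ m y → sumBy (near (suc m)) (image y) ≡ dinvWeight (+ suc m) y
near-image-pos zero (+ zero) = refl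
near-image-pos (suc m) (+ zero) = refl
near-image-pos m (+ suc k) rewrite dinvWeight-pos (+ suc m) k | eqB-pos (suc m) (suc k) | eqB-pos (suc m) (suc (suc k)) = go k
  where
  go : ∀ k → near m k + 0 ≡ fromBool (m ℕ.≡ᵇ k) + fromBool (m ℕ.≡ᵇ suc k) + 0 + fromBool (eqB (+ suc m) (-ℕ k))
  go zero = trans (+-identityʳ _) (trans (near-spec m zero) (sym (trans (+-identityʳ _) (+-identityʳ _))))
  go (suc k) = trans (+-identityʳ _) (trans (near-spec m (suc k)) (sym (trans (+-identityʳ _) (+-identityʳ _))))
near-image-pos m -[1+ k ] rewrite dinvWeight-neg (+ suc m) k | eqB-pos (suc m) (suc k) | eqB-pos (suc m) (suc (suc k)) = go k
  where
  go : ∀ k → near m k + 0 ≡ 0 + fromBool (eqB (+ suc m) (-ℕ k)) + fromBool (m ℕ.≡ᵇ k) + fromBool (m ℕ.≡ᵇ suc k)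
  go zero = trans (+-identityʳ _) (near-spec m zero)
  go (suc k) = trans (+-identityʳ _) (near-spec m (suc k))

near-image-neg : ∀ m y → sumBy (λ u → near u (suc m)) (image y) ≡ dinvWeight -[1+ m ] y
near-image-neg m (+ zero) = refl
near-image-neg m (+ suc k) rewrite dinvWeight-pos -[1+ m ] k | eqB-neg m k = go k
  where
  go : ∀ k → near k m + 0 ≡ 0 + 0 + fromBool (m ℕ.≡ᵇ k) + fromBool (eqB -[1+ m ] (-ℕ k))
  go zero rewrite near-spec zero m | ≡ᵇ-sym zero m = +-identityʳ _
  go (suc k) rewrite near-spec (suc k) m | eqB-neg m k | ≡ᵇ-sym (suc k) m | ≡ᵇ-sym k m = +-identityʳ _
near-image-neg m -[1+ k ] rewrite dinvWeight-neg -[1+ m ] k | eqB-neg m k = go k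
  where
  go : ∀ k → near k m + 0 ≡ fromBool (m ℕ.≡ᵇ k) + fromBool (eqB -[1+ m ] (-ℕ k)) + 0 + 0
  go zero rewrite near-spec zero m | ≡ᵇ-sym zero m = sym (+-identityʳ _)
  go (suc k) rewrite near-spec (suc k) m | eqB-neg m k | ≡ᵇ-sym (suc k) m | ≡ᵇ-sym k m = sym (+-identityʳ _)

near-image-zero : ∀ y → sumBy (near 0) (image y) + sumBy (λ u → near u 0) (image y) ≡ dinvWeight (+ 0) y + 2 * fromBool (eqB y (+ 0))
near-image-zero (+ zero) = refl
near-image-zero (+ suc k) rewrite dinvWeight-pos (+ 0) k = go k
  where
  go : ∀ k → near 0 (suc k) + 0 + (near (suc k) 0 + 0) ≡ fromBool (eqB (+ 0) (+ suc k)) + fromBool (eqB (+ 0) (+ suc (suc k))) + fromBool (eqB (+ 0) -[1+ k ]) + fromBool (eqB (+ 0) (-ℕ k)) + 2 * fromBool (eqB (+ suc k) (+ 0))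
  go zero = refl
  go (suc k) = refl
near-image-zero -[1+ k ] rewrite dinvWeight-neg (+ 0) k = go k
  where
  go : ∀ k → near 0 (suc k) + 0 + (near (suc k) 0 + 0) ≡ fromBool (eqB (+ 0) -[1+ k ]) + fromBool (eqB (+ 0) (-ℕ k)) + fromBool (eqB (+ 0) (+ suc k)) + fromBool (eqB (+ 0) (+ suc (suc k))) + 2 * fromBool (eqB -[1+ k ] (+ 0))
  go zero = refl
  go (suc k) = refl

near-zero-fold : ∀ a → sumBy (near 0) (fold a) + sumBy (λ u → near u 0) (fold a) ≡ sumBy (dinvWeight (+ 0)) a + (zerosℤ a + zerosℤ a)
near-zero-fold a = begin
    sumBy (near 0) (fold a) + sumBy (λ u → near u 0) (fold a)
      ≡⟨ cong₂ _+_ (sumBy-fold (near 0) a) (sumBy-fold (λ u → near u 0) a) ⟩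
    sumBy (λ y → sumBy (near 0) (image y)) a + sumBy (λ y → sumBy (λ u → near u 0) (image y)) a
      ≡⟨ sym (sumBy-+ (λ y → sumBy (near 0) (image y)) (λ y → sumBy (λ u → near u 0) (image y)) a) ⟩
    sumBy (λ y → sumBy (near 0) (image y) + sumBy (λ u → near u 0) (image y)) a
      ≡⟨ sumBy-cong _ _ near-image-zero a ⟩
    sumBy (λ y → dinvWeight (+ 0) y + 2 * fromBool (eqB y (+ 0))) a
      ≡⟨ sumBy-+ (dinvWeight (+ 0)) (λ y → 2 * fromBool (eqB y (+ 0))) a ⟩
    sumBy (dinvWeight (+ 0)) a + sumBy (λ y → 2 * fromBool (eqB y (+ 0))) a
      ≡⟨ cong (λ u → sumBy (dinvWeight (+ 0)) a + u) (trans (sumBy-double (λ y → fromBool (eqB y (+ 0))) a) (sym (cong₂ _+_ zA≡ zA≡))) ⟩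
    sumBy (dinvWeight (+ 0)) a + (zerosℤ a + zerosℤ a) ∎
  where
  open ≡-Reasoning
  zA≡ : zerosℤ a ≡ sumBy (λ y → fromBool (eqB y (+ 0))) a
  zA≡ = length-filterᵇ (λ y → eqB y (+ 0)) a

dinvVec-∷-twiceChoose2 : ∀ x a →
  dinvVec a + (sumBy (dinvWeight x) a + fromBool (eqB x (+ 0))) + twiceChoose2 (fromBool (eqB x (+ 0)) + zerosℤ a)
  ≡ dinvVec (x ∷ a) + twiceChoose2 (zerosℤ (x ∷ a))
dinvVec-∷-twiceChoose2 x a =
  cong₂ (λ u v → u + twiceChoose2 v) (sym (dinvVec-∷ x a)) (sym (length-filterᵇ-∷ (λ y → eqB y (+ 0)) x a))

dinvLevels-fold : ∀ a → dinvLevels (fold a) ≡ dinvVec a + twiceChoose2 (zerosℤ a)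
dinvLevels-fold [] = refl
dinvLevels-fold (+ suc m ∷ a) = begin
    sumBy (near (suc m)) (fold a) + dinvLevels (fold a)
      ≡⟨ cong₂ _+_ (trans (sumBy-fold (near (suc m)) a) (sumBy-cong _ _ (near-image-pos m) a)) (dinvLevels-fold a) ⟩
    sumBy (dinvWeight (+ suc m)) a + (dinvVec a + twiceChoose2 (zerosℤ a))
      ≡⟨ rearrange (sumBy (dinvWeight (+ suc m)) a) (dinvVec a) (twiceChoose2 (zerosℤ a)) ⟩
    dinvVec a + (sumBy (dinvWeight (+ suc m)) a + 0) + twiceChoose2 (zerosℤ a)
      ≡⟨ dinvVec-∷-twiceChoose2 (+ suc m) a ⟩
    dinvVec (+ suc m ∷ a) + twiceChoose2 (zerosℤ (+ suc m ∷ a)) ∎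
  where
  open ≡-Reasoning
  rearrange : ∀ s d t → s + (d + t) ≡ d + (s + 0) + t
  rearrange = solve-∀
dinvLevels-fold (-[1+ m ] ∷ a) = begin
    dinvLevels (fold a ∷ʳ suc m)
      ≡⟨ dinvLevels-∷ʳ (fold a) (suc m) ⟩
    dinvLevels (fold a) + sumBy (λ u → near u (suc m)) (fold a)
      ≡⟨ cong₂ _+_ (dinvLevels-fold a) (trans (sumBy-fold (λ u → near u (suc m)) a) (sumBy-cong _ _ (near-image-neg m) a)) ⟩
    (dinvVec a + twiceChoose2 (zerosℤ a)) + sumBy (dinvWeight -[1+ m ]) a
      ≡⟨ rearrange (sumBy (dinvWeight -[1+ m ]) a) (dinvVec a) (twiceChoose2 (zerosℤ a)) ⟩
    dinvVec a + (sumBy (dinvWeight -[1+ m ]) a + 0) + twiceChoose2 (zerosℤ a)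
      ≡⟨ dinvVec-∷-twiceChoose2 -[1+ m ] a ⟩
    dinvVec (-[1+ m ] ∷ a) + twiceChoose2 (zerosℤ (-[1+ m ] ∷ a)) ∎
  where
  open ≡-Reasoning
  rearrange : ∀ s d t → (d + t) + s ≡ d + (s + 0) + t
  rearrange = solve-∀
dinvLevels-fold (+ zero ∷ a) = begin
    sumBy (near 0) (fold a ∷ʳ 0) + dinvLevels (fold a ∷ʳ 0)
      ≡⟨ cong₂ _+_ (sumBy-∷ʳ (near 0) (fold a) 0) (dinvLevels-∷ʳ (fold a) 0) ⟩
    (sumBy (near 0) (fold a) + 1) + (dinvLevels (fold a) + sumBy (λ u → near u 0) (fold a))
      ≡⟨ rearrange₁ (sumBy (near 0) (fold a)) (dinvLevels (fold a)) (sumBy (λ u → near u 0) (fold a)) ⟩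
    (sumBy (near 0) (fold a) + sumBy (λ u → near u 0) (fold a)) + 1 + dinvLevels (fold a)
      ≡⟨ cong₂ (λ u v → u + 1 + v) (near-zero-fold a) (dinvLevels-fold a) ⟩
    (sumBy (dinvWeight (+ 0)) a + (zerosℤ a + zerosℤ a)) + 1 + (dinvVec a + twiceChoose2 (zerosℤ a))
      ≡⟨ rearrange₂ (sumBy (dinvWeight (+ 0)) a) (zerosℤ a) (dinvVec a) (twiceChoose2 (zerosℤ a)) ⟩
    dinvVec a + (sumBy (dinvWeight (+ 0)) a + 1) + twiceChoose2 (suc (zerosℤ a))
      ≡⟨ dinvVec-∷-twiceChoose2 (+ 0) a ⟩
    dinvVec (+ 0 ∷ a) + twiceChoose2 (zerosℤ (+ 0 ∷ a)) ∎
  where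
  open ≡-Reasoning
  rearrange₁ : ∀ p d q → (p + 1) + (d + q) ≡ (p + q) + 1 + d
  rearrange₁ = solve-∀
  rearrange₂ : ∀ s z d t → (s + (z + z)) + 1 + (d + t) ≡ d + (s + 1) + (t + (z + z))
  rearrange₂ = solve-∀

zeros-fold : ∀ a → zeros (fold a) ≡ zerosℤ a + zerosℤ a
zeros-fold [] = refl
zeros-fold (+ zero ∷ a) rewrite zeros-∷ʳ (fold a) 0 | zeros-fold a = rearrange (zerosℤ a)
  where
  rearrange : ∀ z → suc (z + z + 1) ≡ suc z + suc z
  rearrange = solve-∀
zeros-fold (+ suc m ∷ a) = zeros-fold a
zeros-fold (-[1+ m ] ∷ a) rewrite zeros-∷ʳ (fold a) (suc m) | zeros-fold a = +-identityʳ _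


-- The area of a ballot path, row by row

box : ℕ → ℕ → ℕ → ℕ → ℕ
box n i j x = if ⌊ (i <? j) ×-dec ((i + j) ≤? suc (n + n)) ×-dec (x <? i) ⌋ then 1 else 0

rowArea : ℕ → ℕ → ℕ → ℕ
rowArea n j x = sum (map (λ i → box n i j x) (map suc (upTo (n + n))))

rowArea-low : ∀ n r x → r ≤ n → rowArea n (suc r) x ≡ r ∸ x
rowArea-low n r x rn = trans (count-interval (λ i → (i <? suc r) ×-dec ((i + suc r) ≤? suc (n + n)) ×-dec (x <? i)) x r to fro (n + n))
  (cong (_∸ x) (m≤n⇒m⊓n≡m (≤-trans rn (m≤m+n n n))))
  where
  to : ∀ i → (i < suc r) × ((i + suc r ≤ suc (n + n)) × (x < i)) → (x < i) × (i ≤ r)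
  to i (lt , _ , xi) = xi , ≤-pred lt
  fro : ∀ i → x < i → i ≤ r → (i < suc r) × ((i + suc r ≤ suc (n + n)) × (x < i))
  fro i xi ir = s≤s ir , subst (_≤ suc (n + n)) (sym (+-suc i r)) (s≤s (+-mono-≤ (≤-trans ir rn) rn)) , xi

rowArea-high : ∀ n r x → suc n ≤ r → x + suc r ≤ n + n → rowArea n (suc r) x ≡ ((n + n) ∸ r) ∸ x
rowArea-high n r x nr le = trans (count-interval (λ i → (i <? suc r) ×-dec ((i + suc r) ≤? suc (n + n)) ×-dec (x <? i)) x ((n + n) ∸ r) to fro (n + n))
  (cong (_∸ x) (m≤n⇒m⊓n≡m (m∸n≤m (n + n) r)))
  where
  rle : r ≤ n + n
  rle = ≤-trans (≤-trans (n≤1+n r) (m≤n+m (suc r) x)) le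
  to : ∀ i → (i < suc r) × ((i + suc r ≤ suc (n + n)) × (x < i)) → (x < i) × (i ≤ (n + n) ∸ r)
  to i (lt , le2 , xi) = xi , m+n≤o⇒m≤o∸n i (≤-pred (subst (_≤ suc (n + n)) (+-suc i r) le2))
  fro : ∀ i → x < i → i ≤ (n + n) ∸ r → (i < suc r) × ((i + suc r ≤ suc (n + n)) × (x < i))
  fro i xi ih = s≤s (≤-trans ih hr) , subst (_≤ suc (n + n)) (sym (+-suc i r)) (s≤s (≤-trans (+-monoˡ-≤ r ih) (≤-reflexive (m∸n+n≡m rle)))) , xi
    where
    hr : (n + n) ∸ r ≤ r
    hr = ≤-trans (∸-monoˡ-≤ r (+-mono-≤ (≤-trans (n≤1+n n) nr) (≤-trans (n≤1+n n) nr))) (≤-reflexive (m+n∸n≡m r r))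

rowArea-step-high : ∀ n r x → x ≤ r → suc r + x ≤ n + n → ¬ (r ≤ n) → rowArea n (suc r) x + x + 2 * (r ∸ n) ≡ r
rowArea-step-high n r x xr le ¬rn rewrite rowArea-high n r x (≰⇒> ¬rn) (subst (_≤ n + n) (+-comm (suc r) x) le) = begin
    (n + n) ∸ r ∸ x + x + 2 * (r ∸ n)
      ≡⟨ cong (_+ 2 * (r ∸ n)) (m∸n+n≡m (m+n≤o⇒m≤o∸n x xr')) ⟩
    (n + n) ∸ r + 2 * (r ∸ n)
      ≡⟨ cong (λ z → (n + n) ∸ z + 2 * (z ∸ n)) (sym rEq) ⟩
    (n + n) ∸ (n + d) + 2 * ((n + d) ∸ n)
      ≡⟨ cong₂ (λ u v → u + 2 * v) ([m+n]∸[m+o]≡n∸o n n d) (m+n∸m≡n n d) ⟩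
    n ∸ d + 2 * d
      ≡⟨ rearrange (n ∸ d) d ⟩
    (n ∸ d + d) + d
      ≡⟨ cong (_+ d) (m∸n+n≡m dn) ⟩
    n + d
      ≡⟨ rEq ⟩
    r ∎
  where
  open ≡-Reasoning
  nr : suc n ≤ r
  nr = ≰⇒> ¬rn
  le' : x + suc r ≤ n + n
  le' = subst (_≤ n + n) (+-comm (suc r) x) le
  xr' : x + r ≤ n + n
  xr' = ≤-trans (+-monoʳ-≤ x (n≤1+n r)) le'
  d = r ∸ n
  rEq : n + d ≡ r
  rEq = m+[n∸m]≡n (≤-trans (n≤1+n n) nr)
  dn : d ≤ n
  dn = +-cancelˡ-≤ n d n (≤-trans (≤-reflexive rEq) (≤-trans (≤-trans (n≤1+n r) (m≤n+m (suc r) x)) le'))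
  rearrange : ∀ a d → a + 2 * d ≡ (a + d) + d
  rearrange = solve-∀

-- Row r + 1 of the staircase has r boxes if r ≤ n and 2n − r boxes otherwise; an N step at x in it
-- leaves x of them out.
rowArea-step : ∀ n r x → x ≤ r → suc r + x ≤ n + n → rowArea n (suc r) x + x + 2 * (r ∸ n) ≡ r
rowArea-step n r x xr le with r ℕ.≤? n
... | yes rn rewrite rowArea-low n r x rn | m≤n⇒m∸n≡0 rn = trans (+-identityʳ _) (m∸n+n≡m xr)
... | no ¬rn = rowArea-step-high n r x xr le ¬rn

rowSum : (ℕ → ℕ → ℕ) → ℕ → ℕ → List Step → ℕ
rowSum f r b [] = 0
rowSum f r b (N ∷ p) = f (suc r) b + rowSum f (suc r) b p
rowSum f r b (E ∷ p) = rowSum f r (suc b) p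

rowIndexSum : ℕ → List Step → ℕ
rowIndexSum r [] = 0
rowIndexSum r (N ∷ p) = r + rowIndexSum (suc r) p
rowIndexSum r (E ∷ p) = rowIndexSum r p

excessSum : ℕ → ℕ → List Step → ℕ
excessSum n r [] = 0
excessSum n r (N ∷ p) = 2 * (r ∸ n) + excessSum n (suc r) p
excessSum n r (E ∷ p) = excessSum n r p

rowSum-balance : ∀ n c r b β t → c + b ≡ r → Ballot c β t → r + b + length β ≡ n + n →
  rowSum (rowArea n) r b β + invEN b β + excessSum n r β ≡ rowIndexSum r β
rowSum-balance n c r b [] t e bal len = refl
rowSum-balance n c r b (N ∷ p) t e bal len = begin
    (rowArea n (suc r) b + rowSum (rowArea n) (suc r) b p) + (b + invEN b p) + (2 * (r ∸ n) + excessSum n (suc r) p)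
      ≡⟨ rearrange (rowArea n (suc r) b) (rowSum (rowArea n) (suc r) b p) b (invEN b p) (2 * (r ∸ n)) (excessSum n (suc r) p) ⟩
    (rowArea n (suc r) b + b + 2 * (r ∸ n)) + (rowSum (rowArea n) (suc r) b p + invEN b p + excessSum n (suc r) p)
      ≡⟨ cong₂ _+_ (rowArea-step n r b br le) ih ⟩
    r + rowIndexSum (suc r) p ∎
  where
  open ≡-Reasoning
  rearrange : ∀ w t b q c k → (w + t) + (b + q) + (c + k) ≡ (w + b + c) + (t + q + k)
  rearrange = solve-∀
  br : b ≤ r
  br = subst (b ≤_) e (m≤n+m b c)
  le : suc r + b ≤ n + n
  le = subst (_≤ n + n) (cong suc refl) (≤-trans (≤-reflexive (trans (cong suc (sym (+-identityʳ (r + b)))) (sym (+-suc (r + b) 0)))) (≤-trans (+-monoʳ-≤ (r + b) (s≤s z≤n)) (≤-reflexive len)))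
  ih = rowSum-balance n (suc c) (suc r) b p t (cong suc e) bal (trans (cong suc refl) (trans (sym (+-suc (r + b) (length p))) len))
rowSum-balance n zero r b (E ∷ p) t e () len
rowSum-balance n (suc c) r b (E ∷ p) t e bal len =
  rowSum-balance n c r (suc b) p t (trans (+-suc c b) e) bal (trans (cong (_+ length p) (+-suc r b)) (trans (sym (+-suc (r + b) (length p))) len))

rowIndexSum-choose2 : ∀ r β → rowIndexSum r β + choose2 r ≡ choose2 (r + countN β)
rowIndexSum-choose2 r [] = cong choose2 (sym (+-identityʳ r))
rowIndexSum-choose2 r (N ∷ p) = trans (rearrange r (rowIndexSum (suc r) p) (choose2 r)) (trans (rowIndexSum-choose2 (suc r) p) (cong choose2 (sym (+-suc r (countN p)))))
  where
  rearrange : ∀ r a s → r + a + s ≡ a + (r + s)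
  rearrange = solve-∀
rowIndexSum-choose2 r (E ∷ p) = rowIndexSum-choose2 r p

excess : ℕ → ℕ → ℕ
excess n zero = 0
excess n (suc m) = excess n m + 2 * (m ∸ n)

excessSum-excess : ∀ n r β → excessSum n r β + excess n r ≡ excess n (r + countN β)
excessSum-excess n r [] = cong (excess n) (sym (+-identityʳ r))
excessSum-excess n r (N ∷ p) = trans (rearrange (2 * (r ∸ n)) (excessSum n (suc r) p) (excess n r)) (trans (excessSum-excess n (suc r) p) (cong (excess n) (sym (+-suc r (countN p)))))
  where
  rearrange : ∀ c a s → c + a + s ≡ a + (s + c)
  rearrange = solve-∀
excessSum-excess n r (E ∷ p) = excessSum-excess n r p

excess-≤ : ∀ n m → m ≤ n → excess n m ≡ 0
excess-≤ n zero _ = refl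
excess-≤ n (suc m) le rewrite excess-≤ n m (≤-trans (n≤1+n m) le) | m≤n⇒m∸n≡0 (≤-trans (n≤1+n m) le) = refl

excess-T : ∀ n z → excess n (n + z) ≡ twiceChoose2 z
excess-T n zero = trans (cong (excess n) (+-identityʳ n)) (excess-≤ n n ≤-refl)
excess-T n (suc z) = trans (cong (excess n) (+-suc n z)) (trans (cong₂ _+_ (excess-T n z) (cong (2 *_) (m+n∸m≡n n z))) (cong (_+_ (twiceChoose2 z)) (cong (_+_ z) (+-identityʳ z))))

maybe0 : (ℕ → ℕ) → Maybe ℕ → ℕ
maybe0 g nothing = 0
maybe0 g (just x) = g x

sum-nthNx : ∀ (f : ℕ → ℕ → ℕ) M r b β → countN β ≤ M →
  sum (map (λ i → maybe0 (f (r + suc i)) (nthNx b (suc i) β)) (upTo M)) ≡ rowSum f r b β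
sum-nthNx f M r b [] le = sum-zero (upTo M)
sum-nthNx f M r b (E ∷ p) le = trans (cong sum (map-cong (λ i → cong (maybe0 (f (r + suc i))) (nthE i)) (upTo M))) (sum-nthNx f M r (suc b) p le)
  where
  nthE : ∀ i → nthNx b (suc i) (E ∷ p) ≡ nthNx (suc b) (suc i) p
  nthE zero = refl
  nthE (suc i) = refl
sum-nthNx f zero r b (N ∷ p) ()
sum-nthNx f (suc M) r b (N ∷ p) (s≤s le) = begin
    maybe0 (f (r + 1)) (just b) + sum (map G (applyUpTo suc M))
      ≡⟨ cong₂ _+_ (cong (λ z → f z b) (+-comm r 1)) (cong sum (trans (map-applyUpTo suc G M) (sym (map-upTo (G ∘ suc) M)))) ⟩
    f (suc r) b + sum (map (λ i → G (suc i)) (upTo M))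
      ≡⟨ cong (λ z → f (suc r) b + sum z) (map-cong (λ i → cong (λ z → maybe0 (f z) (nthNx b (suc i) p)) (+-suc r (suc i))) (upTo M)) ⟩
    f (suc r) b + sum (map (λ i → maybe0 (f (suc r + suc i)) (nthNx b (suc i) p)) (upTo M))
      ≡⟨ cong (_+_ (f (suc r) b)) (sum-nthNx f M (suc r) b p le) ⟩
    f (suc r) b + rowSum f (suc r) b p ∎
  where
  open ≡-Reasoning
  G = λ i → maybe0 (f (r + suc i)) (nthNx b (suc i) (N ∷ p))

boxBelow≡box : ∀ n β i j → boxBelow n β i j ≡ maybe0 (box n i j) (nthNx 0 j β)
boxBelow≡box n β i j with nthNx 0 j β
... | nothing = refl
... | just x = refl

sum-box≡rowArea : ∀ n j (m : Maybe ℕ) → sum (map (λ i → maybe0 (box n i j) m) (map suc (upTo (n + n)))) ≡ maybe0 (rowArea n j) m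
sum-box≡rowArea n j nothing = sum-zero (map suc (upTo (n + n)))
sum-box≡rowArea n j (just x) = refl

area≡rowSum : ∀ n β → countN β ≤ n + n → area n β ≡ rowSum (rowArea n) 0 0 β
area≡rowSum n β le = begin
    sum (map (λ j → sum (map (λ i → boxBelow n β i j) rng)) rng)
      ≡⟨ cong sum (map-cong (λ j → trans (cong sum (map-cong (λ i → boxBelow≡box n β i j) rng)) (sum-box≡rowArea n j (nthNx 0 j β))) rng) ⟩
    sum (map (λ j → maybe0 (rowArea n j) (nthNx 0 j β)) (map suc (upTo (n + n))))
      ≡⟨ cong sum (sym (map-∘ (upTo (n + n)))) ⟩
    sum (map (λ i → maybe0 (rowArea n (suc i)) (nthNx 0 (suc i) β)) (upTo (n + n)))
      ≡⟨ sum-nthNx (rowArea n) (n + n) 0 0 β le ⟩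
    rowSum (rowArea n) 0 0 β ∎
  where
  open ≡-Reasoning
  rng = map suc (upTo (n + n))


area-ballot : ∀ n β → InB n β → area n β + invEN 0 β + excess n (countN β) ≡ choose2 (countN β)
area-ballot n β (lenβ , prefixes) = begin
  area n β + invEN 0 β + excess n (countN β)
    ≡⟨ cong₂ (λ x y → x + invEN 0 β + y) (area≡rowSum n β countN≤) (sym (excessSum-excess n 0 β)) ⟩
  rowSum (rowArea n) 0 0 β + invEN 0 β + (excessSum n 0 β + 0)
    ≡⟨ cong (_+_ (rowSum (rowArea n) 0 0 β + invEN 0 β)) (+-identityʳ _) ⟩
  rowSum (rowArea n) 0 0 β + invEN 0 β + excessSum n 0 β
    ≡⟨ rowSum-balance n 0 0 0 β (proj₁ ballot) refl (proj₂ ballot) lenβ ⟩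
  rowIndexSum 0 β
    ≡⟨ trans (sym (+-identityʳ _)) (rowIndexSum-choose2 0 β) ⟩
  choose2 (countN β) ∎
  where
  open ≡-Reasoning
  ballot = inits⇒Ballot 0 β prefixes
  countN≤ : countN β ≤ n + n
  countN≤ = ≤-trans (m≤m+n (countN β) (countE β)) (≤-reflexive (trans (sym (length≡countN+countE β)) lenβ))

module _ {n : ℕ} (π : List Step) (inL : InL n π) where

  countN-zetaC : countN (zetaC n π) ≡ length (levelSeq π)
  countN-zetaC = trans (cong countN (zetaC≡reverse-sweep π inL))
    (trans (countN-reverse (sweep (suc n) (levelSeq π))) (proj₁ (sweep-count (suc n) (levelSeq π) (levelSeq-bounded π inL))))

  length-levelSeq≡ : length (levelSeq π) ≡ n + zerosℤ (areaSeq 0 0 π)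
  length-levelSeq≡ = m+m≡n+n⇒m≡n _ _ (trans (length-levelSeq π inL)
    (trans (cong (_+_ (n + n)) (zeros-fold (areaSeq 0 0 π))) (+-swap-halves n (zerosℤ (areaSeq 0 0 π)))))
    where
    +-swap-halves : ∀ m k → m + m + (k + k) ≡ m + k + (m + k)
    +-swap-halves = solve-∀

  dinvLevels-zetaC : dinvLevels (levelSeq π) + invEN 0 (zetaC n π) ≡ choose2 (length (levelSeq π))
  dinvLevels-zetaC = trans (cong (_+_ (dinvLevels (levelSeq π))) (trans (cong (invEN 0) (zetaC≡reverse-sweep π inL)) (invEN-reverse (sweep (suc n) (levelSeq π)))))
    (dinvLevels+invNE-sweep (suc n) (levelSeq π) (levelSeq-bounded π inL))

dinv≡area∘zetaC : ∀ n π → InL n π → dinv π ≡ area n (zetaC n π)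
dinv≡area∘zetaC n π inL = +-cancelʳ-≡ (invEN 0 β + twiceChoose2 z) _ _ (begin
  dinv π + (invEN 0 β + twiceChoose2 z)
    ≡⟨ cong (λ a′ → dinvVec a′ + (invEN 0 β + twiceChoose2 z)) (areaVecFrom≡areaSeq 0 0 π) ⟩
  dinvVec a + (invEN 0 β + twiceChoose2 z)
    ≡⟨ +-rotate (dinvVec a) (invEN 0 β) (twiceChoose2 z) ⟩
  dinvVec a + twiceChoose2 z + invEN 0 β
    ≡⟨ cong (_+ invEN 0 β) (dinvLevels-fold a) ⟨
  dinvLevels (levelSeq π) + invEN 0 β
    ≡⟨ dinvLevels-zetaC π inL ⟩
  choose2 (length (levelSeq π))
    ≡⟨ cong choose2 (countN-zetaC π inL) ⟨
  choose2 (countN β)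
    ≡⟨ area-ballot n β (zetaC-ballot n π inL) ⟨
  area n β + invEN 0 β + excess n (countN β)
    ≡⟨ cong (λ m → area n β + invEN 0 β + excess n m) (trans (countN-zetaC π inL) (length-levelSeq≡ π inL)) ⟩
  area n β + invEN 0 β + excess n (n + z)
    ≡⟨ cong (_+_ (area n β + invEN 0 β)) (excess-T n z) ⟩
  area n β + invEN 0 β + twiceChoose2 z
    ≡⟨ +-assoc (area n β) (invEN 0 β) (twiceChoose2 z) ⟩
  area n β + (invEN 0 β + twiceChoose2 z) ∎)
  where
  open ≡-Reasoning
  β = zetaC n π
  a = areaSeq 0 0 π
  z = zerosℤ a
  +-rotate : ∀ d i t → d + (i + t) ≡ d + t + i
  +-rotate = solve-∀

theorem4p1 : (n : ℕ) → 1 ≤ n →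
    ((π : List Step) → InL n π → InB n (zetaC n π))
    × ((π π′ : List Step) → InL n π → InL n π′ → zetaC n π ≡ zetaC n π′ → π ≡ π′)
    × ((β : List Step) → InB n β → ∃ (λ π → InL n π × zetaC n π ≡ β))
    × ((π : List Step) → InL n π → dinv π ≡ area n (zetaC n π))
theorem4p1 n _ = zetaC-ballot n , zetaC-injective n , zetaC-surjective n , dinv≡area∘zetaC n
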